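{- In the setting of the context, for all $a_1,\dots,a_n\in V$, \[ \Delta_I(a_1\cdots a_n)=\sum_{\substack{0\le k\le n\\0<j_1<\cdots<j_k\le n}}\ \mathop{⧢}_{p=0}^{k}I\big(a_{j_p};a_{j_p+1}\cdots a_{j_{p+1}-1};a_{j_{p+1}}\big)\otimes a_{j_1}\cdots a_{j_k}, \] where $j_0=0$, $j_{k+1}=n+1$, and one formally sets $a_0$ to be an element of $V\setminus V_0$ and $a_{n+1}$ an element of $V_0$ (only membership in $V_0$ matters in $I$).
   Context: $V=\{v_0,v_1,\dots\}$ with weight $\mathrm{wt}(v_0)=1$, $\mathrm{wt}(v_i)=i$; $V_0\subset V$. $\mathbb Q\langle V\rangle$: free associative algebra identified with $U(\mathrm{Lie}(V))$, shuffle coproduct $\Delta$ (letters primitive, Sweedler notation), antipode $S(a_1\cdots a_n)=(-1)^na_n\cdots a_1$, shuffle product $⧢$. For $t\in\mathrm{Lie}(V)$, $t\triangleright_I$ is the derivation of $\mathrm{Lie}(V)$ with $t\triangleright_Iv=0$ ($v\in V_0$), $t\triangleright_Iv=[v,t]$ ($v\notin V_0$), giving a post-Lie algebra; $\triangleright_I$ extends to $\mathbb Q\langle V\rangle^{\otimes2}$ by $x\triangleright\mathbf1=0$, $\mathbf1\triangleright A=A$, $xA\triangleright y=x\triangleright(A\triangleright y)-(x\triangleright A)\triangleright y$, $A\triangleright BC=(A_{(1)}\triangleright B)(A_{(2)}\triangleright C)$; $A\circledast_IB=A_{(1)}(A_{(2)}\triangleright_IB)$; $\Delta_I$ is dual to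 $\circledast_I$ w.r.t. the pairing making words orthonormal. For letters $v_i,v_j$ and $f\in\mathbb Q\langle V\rangle$: $I(v_i;f;v_j)=f$ if $(v_i,v_j)\in(V\setminus V_0)\times V_0$; $I(v_i;f;v_j)=S(f)$ if $(v_i,v_j)\in V_0\times(V\setminus V_0)$; $I(v_i;f;v_j)=(f\mid\mathbf 1)$ (constant term of $f$) if both are in $V\setminus V_0$ or both in $V_0$. -}

module Defs where

open import Data.Nat using (ℕ; zero; suc; _≡ᵇ_)
open import Data.Bool using (Bool; true; false; if_then_else_; _∧_)
open import Data.List using (List; []; _∷_; _++_; map; concatMap; foldr; reverse; length; zip)
open import Data.Product using (_×_; _,_)
open import Data.Rational using (ℚ; 0ℚ; 1ℚ; _+_; _*_; -_)
open import Data.Vec using (Vec; []; _∷_)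

-- Letters, words, and elements of ℚ⟨V⟩
--   V = {v₀, v₁, …} is modelled by ℕ (letter i = vᵢ); weights play no
--   role in the statement.  The subset V₀ ⊆ V is given by its
--   characteristic function  V₀ : ℕ → Bool.

Letter : Set
Letter = ℕ

Word : Set
Word = List Letter

-- An element of ℚ⟨V⟩ as a finite formal linear combination of words.
Poly : Set
Poly = List (ℚ × Word)

-- An element of ℚ⟨V⟩ ⊗ ℚ⟨V⟩ as a finite formal combination of u ⊗ v.
Poly₂ : Set
Poly₂ = List (ℚ × Word × Word)

wordEq : Word → Word → Bool
wordEq [] [] = true
wordEq [] (_ ∷ _) = false
wordEq (_ ∷ _) [] = false
wordEq (x ∷ u) (y ∷ w) = (x ≡ᵇ y) ∧ wordEq u w

-- coefficient (f ∣ w) of the word w in f  (words are orthonormal)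
coeff : Poly → Word → ℚ
coeff f w = foldr (λ { (c , u) acc → (if wordEq u w then c else 0ℚ) + acc }) 0ℚ f

coeff₂ : Poly₂ → Word → Word → ℚ
coeff₂ T u v = foldr (λ { (c , x , y) acc → (if wordEq x u ∧ wordEq y v then c else 0ℚ) + acc }) 0ℚ T

wordP : Word → Poly
wordP w = (1ℚ , w) ∷ []

one : Poly
one = wordP []

scale : ℚ → Poly → Poly
scale c = map (λ { (d , w) → (c * d , w) })

neg : Poly → Poly
neg = scale (- 1ℚ)

mulP : Poly → Poly → Poly
mulP p q = concatMap (λ { (c , u) → map (λ { (d , w) → (c * d , u ++ w) }) q }) p

-- Lie(V): Lie polynomials as (combinations of) bracket trees

data LieTree : Set where
  leaf : Letter → LieTree
  br   : LieTree → LieTree → LieTree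

LieComb : Set
LieComb = List (ℚ × LieTree)

-- embedding Lie(V) ⊂ U(Lie(V)) = ℚ⟨V⟩,  [s,t] = st − ts
expand : LieTree → Poly
expand (leaf v) = wordP (v ∷ [])
expand (br s t) = mulP (expand s) (expand t) ++ neg (mulP (expand t) (expand s))

module _ (V₀ : Letter → Bool) where

  actLie : LieTree → LieTree → LieComb
  actLie t (leaf v) = if V₀ v then [] else (1ℚ , br (leaf v) t) ∷ []
  actLie t (br a b) =
    map (λ { (c , a') → (c , br a' b) }) (actLie t a) ++
    map (λ { (c , b') → (c , br a b') }) (actLie t b)

  -- t ▷_I on ℚ⟨V⟩ for t ∈ Lie(V) (t primitive, so A ▷ BC = (A₍₁₎▷B)(A₍₂₎▷C)
  -- makes it a derivation with t ▷ 𝟏 = 0)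
  letterAct : LieTree → Letter → Poly
  letterAct t v = if V₀ v then [] else expand (br (leaf v) t)

  derW : LieTree → Word → Poly
  derW t [] = []
  derW t (v ∷ w) = mulP (letterAct t v) (wordP w) ++ mulP (wordP (v ∷ [])) (derW t w)

  derP : LieTree → Poly → Poly
  derP t p = concatMap (λ { (c , w) → scale c (derW t w) }) p

  derVec : ∀ {m} → LieTree → Vec LieTree m → List (ℚ × Vec LieTree m)
  derVec t [] = []
  derVec t (s ∷ T) =
    map (λ { (c , s') → (c , s' ∷ T) }) (actLie t s) ++
    map (λ { (c , T') → (c , s ∷ T') }) (derVec t T)

  -- (t₁ ⋯ tₘ) ▷_I B, defined by  𝟏 ▷ B = B  and
  --   x A ▷ B = x ▷ (A ▷ B) − (x ▷ A) ▷ B     (x ∈ Lie(V)),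
  -- by recursion on the number m of Lie factors.
  act : (m : ℕ) → Vec LieTree m → Poly → Poly
  act zero [] B = B
  act (suc m) (t ∷ T) B =
    derP t (act m T B) ++
    neg (concatMap (λ { (c , T') → scale c (act m T' B) }) (derVec t T))

  leaves : (w : Word) → Vec LieTree (length w)
  leaves [] = []
  leaves (x ∷ w) = leaf x ∷ leaves w

  actW : Word → Poly → Poly
  actW a B = act (length a) (leaves a) B

  -- shuffle coproduct of a word (letters primitive): Σ_S a_S ⊗ a_{Sᶜ}
  deshuffle : Word → List (Word × Word)
  deshuffle [] = ([] , []) ∷ []
  deshuffle (x ∷ w) =
    concatMap (λ { (l , r) → (x ∷ l , r) ∷ (l , x ∷ r) ∷ [] }) (deshuffle w)

  ⊛I : Word → Poly → Poly
  ⊛I A B = concatMap (λ { (l , r) → mulP (wordP l) (actW r B) }) (deshuffle A)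

  -- Δ_I is dual to ⊛_I:  (Δ_I w ∣ u ⊗ v) := (u ⊛_I v ∣ w)
  ΔIcoeff : Word → Word → Word → ℚ
  ΔIcoeff w u v = coeff (⊛I u (wordP v)) w

shuffleW : Word → Word → List Word
shuffleW [] v = v ∷ []
shuffleW (x ∷ u) [] = (x ∷ u) ∷ []
shuffleW (x ∷ u) (y ∷ v) =
  map (x ∷_) (shuffleW u (y ∷ v)) ++ map (y ∷_) (shuffleW (x ∷ u) v)

shP : Poly → Poly → Poly
shP p q = concatMap (λ { (c , u) → concatMap (λ { (d , w) →
            map (λ s → (c * d , s)) (shuffleW u w) }) q }) p

signOf : ℕ → ℚ
signOf zero = 1ℚ
signOf (suc n) = - signOf n

antipodeW : Word → Poly
antipodeW f = (signOf (length f) , reverse f) ∷ []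

constW : Word → Poly
constW [] = one
constW (_ ∷ _) = []

-- I(vᵢ ; f ; vⱼ), where the booleans record whether vᵢ, vⱼ ∈ V₀
Ifun : Bool → Word → Bool → Poly
Ifun false f true  = wordP f
Ifun true  f false = antipodeW f
Ifun false f false = constW f
Ifun true  f true  = constW f

-- all subsets {j₁ < ⋯ < j_k} ⊆ {1,…,n}, as masks of length n
masks : ℕ → List (List Bool)
masks zero = [] ∷ []
masks (suc n) = concatMap (λ m → (true ∷ m) ∷ (false ∷ m) ∷ []) (masks n)

module _ (V₀ : Letter → Bool) where

  -- the triples (a_{j_p} ∈ V₀ ? , a_{j_p+1}⋯a_{j_{p+1}−1} , a_{j_{p+1}} ∈ V₀ ?),
  -- p = 0,…,k; the boundary letters satisfy a₀ ∉ V₀ and a_{n+1} ∈ V₀.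
  pieces : Bool → Word → List (Bool × Letter) → List (Bool × Word × Bool)
  pieces pin seg [] = (pin , seg , true) ∷ []
  pieces pin seg ((true , x) ∷ rest) = (pin , seg , V₀ x) ∷ pieces (V₀ x) [] rest
  pieces pin seg ((false , x) ∷ rest) = pieces pin (seg ++ x ∷ []) rest

  chosen : List (Bool × Letter) → Word
  chosen [] = []
  chosen ((true , x) ∷ rest) = x ∷ chosen rest
  chosen ((false , _) ∷ rest) = chosen rest

  bigShuffle : List (Bool × Word × Bool) → Poly
  bigShuffle = foldr (λ { (b , f , b') acc → shP (Ifun b f b') acc }) one

  rhs : Word → Poly₂
  rhs a = concatMap (λ m → let z = zip m a in
            map (λ { (c , u) → (c , u , chosen z) }) (bigShuffle (pieces false [] z)))
          (masks (length a))

module Submission where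

-- Δ_I is dual to ⊛_I, so it suffices to expand u ⊛_I v = Σ u₍₁₎ (u₍₂₎ ▷_I v) for words u, v.
-- Unfolding the recursion that defines ▷_I, a word r acts on v letter by letter: letters in V₀
-- are inert, and every other letter x absorbs a part of r, split as S(p) x q (since t ▷ x = x t − t x).
-- Grouping the letters of u by the letter of v that absorbs them, the antipode identity
-- Σ u₍₁₎ S(u₍₂₎) = ε(u) cancels everything except the configurations of the theorem: this gives
-- u ⊛_I v in closed form, and its coefficients are read off through the duality of ⧢ and Δ.

open import Defs
open import Algebra.Bundles using (CommutativeMonoid)
import Algebra.Solver.CommutativeMonoid
open import Data.Bool using (Bool; true; false; if_then_else_; _∧_; T)
open import Data.Bool.Properties using (⇔→≡)
open import Data.Nat using (zero; suc; _≡ᵇ_; _≤_; z≤n; s≤s)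
import Data.Nat.Properties as ℕ
open import Data.List using (List; []; _∷_; _++_; map; concatMap; reverse; length; zip)
import Data.List.Properties as List
open import Data.Product using (_×_; _,_; proj₁; proj₂)
open import Data.Rational using (ℚ; 0ℚ; 1ℚ; _+_; _*_; -_)
open import Data.Rational.Properties
open import Data.Rational.Solver using (module +-*-Solver)
open import Data.Unit using (tt)
open import Data.Vec using (Vec; []; _∷_; toList)
open import Function.Bundles using (mk⇔)
open import Relation.Binary.PropositionalEquality
open import Relation.Binary.Bundles using (Setoid)
import Relation.Binary.Reasoning.Setoid as SetoidReasoning
open +-*-Solver using (_:+_; _:*_; :-_; _:=_; con) renaming (solve to solveℚ)

≡ᵇ-refl : ∀ x → (x ≡ᵇ x) ≡ true
≡ᵇ-refl zero = refl
≡ᵇ-refl (suc x) = ≡ᵇ-refl x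

≡ᵇ-sym : ∀ m n → (m ≡ᵇ n) ≡ (n ≡ᵇ m)
≡ᵇ-sym zero zero = refl
≡ᵇ-sym zero (suc n) = refl
≡ᵇ-sym (suc m) zero = refl
≡ᵇ-sym (suc m) (suc n) = ≡ᵇ-sym m n

wordEq-refl : ∀ w → wordEq w w ≡ true
wordEq-refl [] = refl
wordEq-refl (x ∷ w) rewrite ≡ᵇ-refl x | wordEq-refl w = refl

wordEq-sound : ∀ u w → wordEq u w ≡ true → u ≡ w
wordEq-sound [] [] e = refl
wordEq-sound (x ∷ u) (y ∷ w) e with x ≡ᵇ y in ex
... | true = cong₂ _∷_ (ℕ.≡ᵇ⇒≡ x y (subst T (sym ex) tt)) (wordEq-sound u w e)

wordEq-complete : ∀ {u w} → u ≡ w → wordEq u w ≡ true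
wordEq-complete {u} refl = wordEq-refl u

wordEq-≡ : ∀ {u w u' w'} → (u ≡ w → u' ≡ w') → (u' ≡ w' → u ≡ w) → wordEq u w ≡ wordEq u' w'
wordEq-≡ {u} {w} {u'} {w'} to from = ⇔→≡ (mk⇔ (λ e → wordEq-complete (to (wordEq-sound u w e)))
                                              (λ e → wordEq-complete (from (wordEq-sound u' w' e))))

wordEq-sym : ∀ u w → wordEq u w ≡ wordEq w u
wordEq-sym u w = wordEq-≡ {u} {w} sym sym

wordEq-reverse : ∀ u w → wordEq (reverse u) w ≡ wordEq (reverse w) u
wordEq-reverse u w = wordEq-≡ {reverse u} {w} (λ e → trans (cong reverse (sym e)) (List.reverse-involutive u))
                              (λ e → trans (cong reverse (sym e)) (List.reverse-involutive w))

-- Polynomials are lists of monomials with repetitions, so they are compared by their coefficients.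
infix 4 _≈_
record _≈_ (p q : Poly) : Set where
  constructor ≈i
  field at : ∀ w → coeff p w ≡ coeff q w
open _≈_ public

≈-refl : ∀ {p} → p ≈ p
≈-refl = ≈i λ w → refl

≈-sym : ∀ {p q} → p ≈ q → q ≈ p
≈-sym e = ≈i λ w → sym (at e w)

≈-trans : ∀ {p q r} → p ≈ q → q ≈ r → p ≈ r
≈-trans e f = ≈i λ w → trans (at e w) (at f w)

≡⇒≈ : ∀ {p q} → p ≡ q → p ≈ q
≡⇒≈ refl = ≈-refl

≈-setoid : Setoid _ _
≈-setoid = record { Carrier = Poly ; _≈_ = _≈_
                  ; isEquivalence = record { refl = ≈-refl ; sym = ≈-sym ; trans = ≈-trans } }

module ≈-Reasoning = SetoidReasoning ≈-setoid

coeff-++ : ∀ p q w → coeff (p ++ q) w ≡ coeff p w + coeff q w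
coeff-++ [] q w = sym (+-identityˡ (coeff q w))
coeff-++ ((c , u) ∷ p) q w =
  trans (cong ((if wordEq u w then c else 0ℚ) +_) (coeff-++ p q w)) (sym (+-assoc (if wordEq u w then c else 0ℚ) (coeff p w) (coeff q w)))

if-*ʳ : ∀ b (c d : ℚ) → (if b then c * d else 0ℚ) ≡ c * (if b then d else 0ℚ)
if-*ʳ true c d = refl
if-*ʳ false c d = sym (*-zeroʳ c)

coeff-scale : ∀ c p w → coeff (scale c p) w ≡ c * coeff p w
coeff-scale c [] w = sym (*-zeroʳ c)
coeff-scale c ((d , u) ∷ p) w =
  trans (cong₂ _+_ (if-*ʳ (wordEq u w) c d) (coeff-scale c p w))
        (sym (*-distribˡ-+ c (if wordEq u w then d else 0ℚ) (coeff p w)))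

-1*x≡-x : ∀ x → - 1ℚ * x ≡ - x
-1*x≡-x = solveℚ 1 (λ x → con (- 1ℚ) :* x := :- x) refl

coeff-neg : ∀ p w → coeff (neg p) w ≡ - coeff p w
coeff-neg p w = trans (coeff-scale (- 1ℚ) p w) (-1*x≡-x (coeff p w))

coeff-wordP : ∀ u w → coeff (wordP u) w ≡ (if wordEq u w then 1ℚ else 0ℚ)
coeff-wordP u w = +-identityʳ _

++-cong : ∀ {p p' q q'} → p ≈ p' → q ≈ q' → p ++ q ≈ p' ++ q'
++-cong {p} {p'} {q} {q'} e f =
  ≈i λ w → trans (coeff-++ p q w) (trans (cong₂ _+_ (at e w) (at f w)) (sym (coeff-++ p' q' w)))

++-comm≈ : ∀ p q → p ++ q ≈ q ++ p
++-comm≈ p q = ≈i λ w → trans (coeff-++ p q w) (trans (+-comm (coeff p w) (coeff q w)) (sym (coeff-++ q p w)))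

++-commutativeMonoid : CommutativeMonoid _ _
++-commutativeMonoid = record
  { Carrier = Poly ; _≈_ = _≈_ ; _∙_ = _++_ ; ε = []
  ; isCommutativeMonoid = record
    { isMonoid = record
      { isSemigroup = record
        { isMagma = record { isEquivalence = Setoid.isEquivalence ≈-setoid ; ∙-cong = ++-cong }
        ; assoc = λ p q r → ≡⇒≈ (List.++-assoc p q r) }
      ; identity = (λ p → ≈-refl) , (λ p → ≡⇒≈ (List.++-identityʳ p)) }
    ; comm = ++-comm≈ } }

module ++-Solver = Algebra.Solver.CommutativeMonoid ++-commutativeMonoid

interchange : ∀ a b x y → (a ++ b) ++ (x ++ y) ≈ (a ++ x) ++ (b ++ y)
interchange a b x y = solve 4 (λ a b x y → (a ⊕ b) ⊕ (x ⊕ y) ⊜ (a ⊕ x) ⊕ (b ⊕ y)) ≈-refl a b x y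
  where open ++-Solver

scale-cong : ∀ c {p q} → p ≈ q → scale c p ≈ scale c q
scale-cong c {p} {q} e =
  ≈i λ w → trans (coeff-scale c p w) (trans (cong (c *_) (at e w)) (sym (coeff-scale c q w)))

neg-cong : ∀ {p q} → p ≈ q → neg p ≈ neg q
neg-cong = scale-cong (- 1ℚ)

scale-++ : ∀ c p q → scale c (p ++ q) ≡ scale c p ++ scale c q
scale-++ c p q = List.map-++ _ p q

scale-scale : ∀ c d p → scale c (scale d p) ≈ scale (c * d) p
scale-scale c d p = ≈i λ w →
  trans (coeff-scale c (scale d p) w) (trans (cong (c *_) (coeff-scale d p w))
  (trans (sym (*-assoc c d (coeff p w))) (sym (coeff-scale (c * d) p w))))

scale-1 : ∀ p → scale 1ℚ p ≈ p
scale-1 p = ≈i λ w → trans (coeff-scale 1ℚ p w) (*-identityˡ (coeff p w))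

scale-neg : ∀ s p → scale (- s) p ≈ scale s (neg p)
scale-neg s p = ≈i λ w →
  trans (coeff-scale (- s) p w) (trans (lem s (coeff p w)) (sym (trans (coeff-scale s (neg p) w) (cong (s *_) (coeff-neg p w)))))
  where
  lem : ∀ s y → - s * y ≡ s * (- y)
  lem = solveℚ 2 (λ s y → (:- s) :* y := s :* (:- y)) refl

scale-neg-comm : ∀ s p → scale s (neg p) ≈ neg (scale s p)
scale-neg-comm s p = ≈i λ w →
  trans (coeff-scale s (neg p) w) (trans (cong (s *_) (coeff-neg p w))
  (trans (lem s (coeff p w)) (trans (cong -_ (sym (coeff-scale s p w))) (sym (coeff-neg (scale s p) w)))))
  where
  lem : ∀ a b → a * (- b) ≡ - (a * b)
  lem = solveℚ 2 (λ a b → a :* (:- b) := :- (a :* b)) refl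

++-neg : ∀ p → p ++ neg p ≈ []
++-neg p = ≈i λ w → trans (coeff-++ p (neg p) w) (trans (cong (coeff p w +_) (coeff-neg p w)) (+-inverseʳ (coeff p w)))

++-assoc≈ : ∀ p q r → (p ++ q) ++ r ≈ p ++ (q ++ r)
++-assoc≈ p q r = ≡⇒≈ (List.++-assoc p q r)

++-[] : ∀ p → p ++ [] ≈ p
++-[] p = ≡⇒≈ (List.++-identityʳ p)

Σq : ∀ {A : Set} → List A → (A → ℚ) → ℚ
Σq [] f = 0ℚ
Σq (a ∷ as) f = f a + Σq as f

Σq-++ : ∀ {A : Set} (xs ys : List A) f → Σq (xs ++ ys) f ≡ Σq xs f + Σq ys f
Σq-++ [] ys f = sym (+-identityˡ _)
Σq-++ (x ∷ xs) ys f = trans (cong (f x +_) (Σq-++ xs ys f)) (sym (+-assoc (f x) (Σq xs f) (Σq ys f)))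

Σq-cong : ∀ {A : Set} (xs : List A) {f g} → (∀ a → f a ≡ g a) → Σq xs f ≡ Σq xs g
Σq-cong [] e = refl
Σq-cong (x ∷ xs) e = cong₂ _+_ (e x) (Σq-cong xs e)

Σq-map : ∀ {A B : Set} (g : A → B) xs f → Σq (map g xs) f ≡ Σq xs (λ a → f (g a))
Σq-map g [] f = refl
Σq-map g (x ∷ xs) f = cong (f (g x) +_) (Σq-map g xs f)

Σq-concatMap : ∀ {A B : Set} (g : A → List B) xs f → Σq (concatMap g xs) f ≡ Σq xs (λ a → Σq (g a) f)
Σq-concatMap g [] f = refl
Σq-concatMap g (x ∷ xs) f = trans (Σq-++ (g x) (concatMap g xs) f) (cong (Σq (g x) f +_) (Σq-concatMap g xs f))

Σq-+ : ∀ {A : Set} (xs : List A) f g → Σq xs (λ a → f a + g a) ≡ Σq xs f + Σq xs g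
Σq-+ [] f g = sym (+-identityˡ 0ℚ)
Σq-+ (x ∷ xs) f g = trans (cong (f x + g x +_) (Σq-+ xs f g)) (lem (f x) (g x) (Σq xs f) (Σq xs g))
  where
  lem : ∀ a b x y → (a + b) + (x + y) ≡ (a + x) + (b + y)
  lem = solveℚ 4 (λ a b x y → (a :+ b) :+ (x :+ y) := (a :+ x) :+ (b :+ y)) refl

Σq-*ˡ : ∀ {A : Set} c (xs : List A) f → Σq xs (λ a → c * f a) ≡ c * Σq xs f
Σq-*ˡ c [] f = sym (*-zeroʳ c)
Σq-*ˡ c (x ∷ xs) f = trans (cong (c * f x +_) (Σq-*ˡ c xs f)) (sym (*-distribˡ-+ c (f x) (Σq xs f)))

Σq-*ʳ : ∀ {A : Set} c (xs : List A) f → Σq xs (λ a → f a * c) ≡ Σq xs f * c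
Σq-*ʳ c xs f = trans (Σq-cong xs (λ a → *-comm (f a) c)) (trans (Σq-*ˡ c xs f) (*-comm c (Σq xs f)))

Σq-zero : ∀ {A : Set} (xs : List A) {f} → (∀ a → f a ≡ 0ℚ) → Σq xs f ≡ 0ℚ
Σq-zero [] e = refl
Σq-zero (x ∷ xs) e = trans (cong₂ _+_ (e x) (Σq-zero xs e)) (+-identityˡ 0ℚ)

Σq-swap : ∀ {A B : Set} (xs : List A) (ys : List B) (f : A → B → ℚ) →
  Σq xs (λ a → Σq ys (f a)) ≡ Σq ys (λ b → Σq xs (λ a → f a b))
Σq-swap [] ys f = sym (Σq-zero ys (λ b → refl))
Σq-swap (x ∷ xs) ys f = trans (cong (Σq ys (f x) +_) (Σq-swap xs ys f)) (sym (Σq-+ ys (f x) _))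

Σq-* : ∀ {A B : Set} (xs : List A) (ys : List B) f g →
  Σq xs f * Σq ys g ≡ Σq xs (λ a → Σq ys (λ b → f a * g b))
Σq-* xs ys f g = trans (sym (Σq-*ʳ (Σq ys g) xs f)) (Σq-cong xs (λ a → sym (Σq-*ˡ (f a) ys g)))

pair : Poly → (Word → ℚ) → ℚ
pair p g = Σq p (λ cu → proj₁ cu * g (proj₂ cu))

pair-++ : ∀ p q g → pair (p ++ q) g ≡ pair p g + pair q g
pair-++ p q g = Σq-++ p q _

pair-scale : ∀ c p g → pair (scale c p) g ≡ c * pair p g
pair-scale c [] g = sym (*-zeroʳ c)
pair-scale c ((d , u) ∷ p) g =
  trans (cong₂ _+_ (*-assoc c d (g u)) (pair-scale c p g)) (sym (*-distribˡ-+ c (d * g u) (pair p g)))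

pair-neg : ∀ p g → pair (neg p) g ≡ - pair p g
pair-neg p g = trans (pair-scale (- 1ℚ) p g) (-1*x≡-x (pair p g))

removeWord : Word → Poly → Poly
removeWord u [] = []
removeWord u ((c , x) ∷ p) = if wordEq x u then removeWord u p else (c , x) ∷ removeWord u p

removeWord-length : ∀ u p → length (removeWord u p) ≤ length p
removeWord-length u [] = z≤n
removeWord-length u ((c , x) ∷ p) with wordEq x u
... | true = ℕ.m≤n⇒m≤1+n (removeWord-length u p)
... | false = s≤s (removeWord-length u p)

pair-removeWord : ∀ u p g → pair p g ≡ coeff p u * g u + pair (removeWord u p) g
pair-removeWord u [] g = sym (trans (+-identityʳ _) (*-zeroˡ (g u)))
pair-removeWord u ((c , x) ∷ p) g with wordEq x u in e
... | true rewrite wordEq-sound x u e =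
  trans (cong (c * g u +_) (pair-removeWord u p g)) (lem c (coeff p u) (g u) (pair (removeWord u p) g))
  where
  lem : ∀ a e g d → a * g + (e * g + d) ≡ (a + e) * g + d
  lem = solveℚ 4 (λ a e g d → a :* g :+ (e :* g :+ d) := (a :+ e) :* g :+ d) refl
... | false = trans (cong (c * g x +_) (pair-removeWord u p g)) (lem (c * g x) (coeff p u) (g u) (pair (removeWord u p) g))
  where
  lem : ∀ a e g d → a + (e * g + d) ≡ (0ℚ + e) * g + (a + d)
  lem = solveℚ 4 (λ a e g d → a :+ (e :* g :+ d) := (con 0ℚ :+ e) :* g :+ (a :+ d)) refl

coeff-removeWord : ∀ u p w → wordEq u w ≡ false → coeff (removeWord u p) w ≡ coeff p w
coeff-removeWord u [] w ne = refl
coeff-removeWord u ((c , x) ∷ p) w ne with wordEq x u in e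
... | true rewrite wordEq-sound x u e | ne = trans (coeff-removeWord u p w ne) (sym (+-identityˡ _))
... | false = cong ((if wordEq x w then c else 0ℚ) +_) (coeff-removeWord u p w ne)

coeff-removeWord-self : ∀ u p → coeff (removeWord u p) u ≡ 0ℚ
coeff-removeWord-self u [] = refl
coeff-removeWord-self u ((c , x) ∷ p) with wordEq x u in e
... | true = coeff-removeWord-self u p
... | false rewrite e = trans (+-identityˡ _) (coeff-removeWord-self u p)

-- n bounds the length of p, since removeWord is not a structural recursion.
pair-zero : ∀ n p g → length p ≤ n → (∀ w → coeff p w ≡ 0ℚ) → pair p g ≡ 0ℚ
pair-zero n [] g l z = refl
pair-zero (suc n) ((c , u) ∷ p) g (s≤s l) z = begin
  c * g u + pair p g                                   ≡⟨ cong (c * g u +_) (pair-removeWord u p g) ⟩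
  c * g u + (coeff p u * g u + pair (removeWord u p) g) ≡⟨ lem c (coeff p u) (g u) _ ⟩
  (c + coeff p u) * g u + pair (removeWord u p) g      ≡⟨ cong₂ _+_ (cong (_* g u) cu) rest ⟩
  0ℚ * g u + 0ℚ                                        ≡⟨ trans (+-identityʳ _) (*-zeroˡ (g u)) ⟩
  0ℚ                                                   ∎
  where
  open ≡-Reasoning
  lem : ∀ a e g d → a * g + (e * g + d) ≡ (a + e) * g + d
  lem = solveℚ 4 (λ a e g d → a :* g :+ (e :* g :+ d) := (a :+ e) :* g :+ d) refl
  cu : c + coeff p u ≡ 0ℚ
  cu = trans (cong (λ b → (if b then c else 0ℚ) + coeff p u) (sym (wordEq-refl u))) (z u)
  rest-coeff : ∀ w → coeff (removeWord u p) w ≡ 0ℚ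
  rest-coeff w with wordEq u w in e
  ... | true rewrite wordEq-sound u w e = coeff-removeWord-self w p
  ... | false = trans (coeff-removeWord u p w e)
                  (trans (sym (+-identityˡ _)) (trans (cong (λ b → (if b then c else 0ℚ) + coeff p w) (sym e)) (z w)))
  rest : pair (removeWord u p) g ≡ 0ℚ
  rest = pair-zero n (removeWord u p) g (ℕ.≤-trans (removeWord-length u p) l) rest-coeff

pair-cong : ∀ {p q} → p ≈ q → ∀ g → pair p g ≡ pair q g
pair-cong {p} {q} e g = x-y≡0⇒x≡y (begin
  pair p g + - pair q g    ≡⟨ sym (trans (pair-++ p (neg q) g) (cong (pair p g +_) (pair-neg q g))) ⟩
  pair (p ++ neg q) g      ≡⟨ pair-zero (length (p ++ neg q)) (p ++ neg q) g ℕ.≤-refl difference-vanishes ⟩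
  0ℚ                       ∎)
  where
  open ≡-Reasoning
  difference-vanishes : ∀ w → coeff (p ++ neg q) w ≡ 0ℚ
  difference-vanishes w =
    trans (coeff-++ p (neg q) w) (trans (cong₂ _+_ (at e w) (coeff-neg q w)) (+-inverseʳ (coeff q w)))
  x-y≡0⇒x≡y : ∀ {x y} → x + - y ≡ 0ℚ → x ≡ y
  x-y≡0⇒x≡y {x} {y} h = trans (solveℚ 2 (λ x y → x := (x :+ :- y) :+ y) refl x y) (trans (cong (_+ y) h) (+-identityˡ y))

pair-* : ∀ p d g → pair p (λ u → d * g u) ≡ d * pair p g
pair-* p d g = trans (Σq-cong p (λ cu → lem (proj₁ cu) d (g (proj₂ cu)))) (Σq-*ˡ d p _)
  where
  lem : ∀ c d x → c * (d * x) ≡ d * (c * x)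
  lem = solveℚ 3 (λ c d x → c :* (d :* x) := d :* (c :* x)) refl

pair-congᶠ : ∀ p {g h} → (∀ u → g u ≡ h u) → pair p g ≡ pair p h
pair-congᶠ p e = Σq-cong p (λ cu → cong (proj₁ cu *_) (e (proj₂ cu)))

pair-0 : ∀ p → pair p (λ _ → 0ℚ) ≡ 0ℚ
pair-0 p = Σq-zero p (λ cu → *-zeroʳ (proj₁ cu))

pair-Σq : ∀ {A : Set} p (xs : List A) (g : Word → A → ℚ) → pair p (λ u → Σq xs (g u)) ≡ Σq xs (λ a → pair p (λ u → g u a))
pair-Σq p xs g =
  trans (Σq-cong p (λ cu → sym (Σq-*ˡ (proj₁ cu) xs (g (proj₂ cu))))) (Σq-swap p xs _)

pair-swap : ∀ p q (h : Word → Word → ℚ) → pair p (λ u → pair q (h u)) ≡ pair q (λ v → pair p (λ u → h u v))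
pair-swap p q h = trans (pair-Σq p q _) (Σq-cong q (λ dv → pair-* p (proj₁ dv) (λ u → h u (proj₂ dv))))

abstract
  linExt : (Word → Poly) → Poly → Poly
  linExt F p = concatMap (λ { (c , w) → scale c (F w) }) p

  linExt-[] : ∀ F → linExt F [] ≡ []
  linExt-[] F = refl

  linExt-∷ : ∀ F c u p → linExt F ((c , u) ∷ p) ≡ scale c (F u) ++ linExt F p
  linExt-∷ F c u p = refl

  linExt-++ : ∀ F p q → linExt F (p ++ q) ≡ linExt F p ++ linExt F q
  linExt-++ F p q = List.concatMap-++ _ p q

coeff-linExt : ∀ F p w → coeff (linExt F p) w ≡ pair p (λ u → coeff (F u) w)
coeff-linExt F [] w rewrite linExt-[] F = refl
coeff-linExt F ((c , u) ∷ p) w rewrite linExt-∷ F c u p =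
  trans (coeff-++ (scale c (F u)) (linExt F p) w) (cong₂ _+_ (coeff-scale c (F u) w) (coeff-linExt F p w))

linExt-cong : ∀ F {p q} → p ≈ q → linExt F p ≈ linExt F q
linExt-cong F {p} {q} e = ≈i λ w → trans (coeff-linExt F p w) (trans (pair-cong e _) (sym (coeff-linExt F q w)))

linExt-congᶠ : ∀ {F G} p → (∀ u → F u ≈ G u) → linExt F p ≈ linExt G p
linExt-congᶠ {F} {G} [] e rewrite linExt-[] F | linExt-[] G = ≈-refl
linExt-congᶠ {F} {G} ((c , u) ∷ p) e rewrite linExt-∷ F c u p | linExt-∷ G c u p =
  ++-cong (scale-cong c (e u)) (linExt-congᶠ p e)

linExt-scale : ∀ F c p → linExt F (scale c p) ≈ scale c (linExt F p)
linExt-scale F c [] rewrite linExt-[] F = ≈-refl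
linExt-scale F c ((d , u) ∷ p) rewrite linExt-∷ F (c * d) u (scale c p) | linExt-∷ F d u p =
  ≈-trans (++-cong (≈-sym (scale-scale c d (F u))) (linExt-scale F c p))
          (≡⇒≈ (sym (scale-++ c (scale d (F u)) (linExt F p))))

linExt-wordP : ∀ F u → linExt F (wordP u) ≈ F u
linExt-wordP F u rewrite linExt-∷ F 1ℚ u [] | linExt-[] F = ≈-trans (++-[] _) (scale-1 (F u))

linExt-linExt : ∀ F G p → linExt F (linExt G p) ≈ linExt (λ u → linExt F (G u)) p
linExt-linExt F G [] rewrite linExt-[] G | linExt-[] F | linExt-[] (λ u → linExt F (G u)) = ≈-refl
linExt-linExt F G ((c , u) ∷ p) rewrite linExt-∷ G c u p | linExt-∷ (λ u → linExt F (G u)) c u p =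
  ≈-trans (≡⇒≈ (linExt-++ F (scale c (G u)) (linExt G p))) (++-cong (linExt-scale F c (G u)) (linExt-linExt F G p))

linExt-wordP-id : ∀ p → linExt wordP p ≈ p
linExt-wordP-id p = ≈i λ w → trans (coeff-linExt wordP p w) (pair-δ p w)
  where
  pair-δ : ∀ p w → pair p (λ u → coeff (wordP u) w) ≡ coeff p w
  pair-δ [] w = refl
  pair-δ ((c , u) ∷ p) w = cong₂ _+_ 
    (trans (cong (c *_) (coeff-wordP u w)) (trans (sym (if-*ʳ (wordEq u w) c 1ℚ)) (lem (wordEq u w)))) (pair-δ p w)
    where
    lem : ∀ b → (if b then c * 1ℚ else 0ℚ) ≡ (if b then c else 0ℚ)
    lem true = *-identityʳ c
    lem false = refl

linExt-++ᶠ : ∀ A B p → linExt (λ u → A u ++ B u) p ≈ linExt A p ++ linExt B p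
linExt-++ᶠ A B [] rewrite linExt-[] (λ u → A u ++ B u) | linExt-[] A | linExt-[] B = ≈-refl
linExt-++ᶠ A B ((c , u) ∷ p) rewrite linExt-∷ (λ u → A u ++ B u) c u p | linExt-∷ A c u p | linExt-∷ B c u p =
  ≈-trans (++-cong (≡⇒≈ (scale-++ c (A u) (B u))) (linExt-++ᶠ A B p))
          (interchange (scale c (A u)) (scale c (B u)) (linExt A p) (linExt B p))

linExt-scaleᶠ : ∀ c A p → linExt (λ u → scale c (A u)) p ≈ scale c (linExt A p)
linExt-scaleᶠ c A p = ≈i λ w → begin
  coeff (linExt (λ u → scale c (A u)) p) w   ≡⟨ coeff-linExt _ p w ⟩
  pair p (λ u → coeff (scale c (A u)) w)     ≡⟨ pair-congᶠ p (λ u → coeff-scale c (A u) w) ⟩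
  pair p (λ u → c * coeff (A u) w)           ≡⟨ pair-* p c _ ⟩
  c * pair p (λ u → coeff (A u) w)           ≡⟨ cong (c *_) (sym (coeff-linExt A p w)) ⟩
  c * coeff (linExt A p) w                   ≡⟨ sym (coeff-scale c (linExt A p) w) ⟩
  coeff (scale c (linExt A p)) w             ∎
  where open ≡-Reasoning

linExt-zero : ∀ {A} p → (∀ u → A u ≈ []) → linExt A p ≈ []
linExt-zero {A} p z = ≈i λ w → trans (coeff-linExt A p w) (trans (pair-congᶠ p (λ u → at (z u) w)) (pair-0 p))

linExt-swap : ∀ p q (H : Word → Word → Poly) →
  linExt (λ u → linExt (H u) q) p ≈ linExt (λ v → linExt (λ u → H u v) p) q
linExt-swap p q H = ≈i λ w → begin
  coeff (linExt (λ u → linExt (H u) q) p) w            ≡⟨ coeff-linExt _ p w ⟩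
  pair p (λ u → coeff (linExt (H u) q) w)              ≡⟨ pair-congᶠ p (λ u → coeff-linExt (H u) q w) ⟩
  pair p (λ u → pair q (λ v → coeff (H u v) w))        ≡⟨ pair-swap p q (λ u v → coeff (H u v) w) ⟩
  pair q (λ v → pair p (λ u → coeff (H u v) w))        ≡⟨ sym (pair-congᶠ q (λ v → coeff-linExt (λ u → H u v) p w)) ⟩
  pair q (λ v → coeff (linExt (λ u → H u v) p) w)      ≡⟨ sym (coeff-linExt _ q w) ⟩
  coeff (linExt (λ v → linExt (λ u → H u v) p) q) w    ∎
  where open ≡-Reasoning

lmul : Word → Poly → Poly
lmul u = linExt (λ v → wordP (u ++ v))

-- An opaque copy of the concatenation product, so that its lemmas are not unfolded by unification.
abstract
  mul : Poly → Poly → Poly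
  mul = mulP

  mul≡mulP : ∀ p q → mul p q ≡ mulP p q
  mul≡mulP p q = refl

mulP-linExt : ∀ p q → mulP p q ≈ linExt (λ u → lmul u q) p
mulP-linExt [] q rewrite linExt-[] (λ u → lmul u q) = ≈-refl
mulP-linExt ((c , u) ∷ p) q rewrite linExt-∷ (λ u → lmul u q) c u p = ++-cong (row q) (mulP-linExt p q)
  where
  row : ∀ q → map (λ { (d , w) → (c * d , u ++ w) }) q ≈ scale c (lmul u q)
  row [] rewrite linExt-[] (λ v → wordP (u ++ v)) = ≈-refl
  row ((d , v) ∷ q) rewrite linExt-∷ (λ v → wordP (u ++ v)) d v q =
    ≈i λ w → cong₂ _+_ (cong (λ z → if wordEq (u ++ v) w then c * z else 0ℚ) (sym (*-identityʳ d))) (at (row q) w)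

mul≈mulP : ∀ p q → mul p q ≈ mulP p q
mul≈mulP p q = ≡⇒≈ (mul≡mulP p q)

mul-linExt : ∀ p q → mul p q ≈ linExt (λ u → lmul u q) p
mul-linExt p q = ≈-trans (mul≈mulP p q) (mulP-linExt p q)

mul-cong : ∀ {p p' q q'} → p ≈ p' → q ≈ q' → mul p q ≈ mul p' q'
mul-cong {p} {p'} {q} {q'} e f = begin
  mul p q                           ≈⟨ mul-linExt p q ⟩
  linExt (λ u → lmul u q) p         ≈⟨ linExt-cong _ e ⟩
  linExt (λ u → lmul u q) p'        ≈⟨ linExt-congᶠ p' (λ u → linExt-cong _ f) ⟩
  linExt (λ u → lmul u q') p'       ≈⟨ mul-linExt p' q' ⟨
  mul p' q'                         ∎
  where open ≈-Reasoning

mul-congˡ : ∀ {p p'} q → p ≈ p' → mul p q ≈ mul p' q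
mul-congˡ q e = mul-cong e ≈-refl

mul-congʳ : ∀ p {q q'} → q ≈ q' → mul p q ≈ mul p q'
mul-congʳ p e = mul-cong {p} ≈-refl e

mul-++ˡ : ∀ p p' q → mul (p ++ p') q ≈ mul p q ++ mul p' q
mul-++ˡ p p' q =
  ≈-trans (mul-linExt (p ++ p') q) (≈-trans (≡⇒≈ (linExt-++ _ p p'))
          (++-cong (≈-sym (mul-linExt p q)) (≈-sym (mul-linExt p' q))))

mul-++ʳ : ∀ p q q' → mul p (q ++ q') ≈ mul p q ++ mul p q'
mul-++ʳ p q q' = begin
  mul p (q ++ q')                                           ≈⟨ mul-linExt p (q ++ q') ⟩
  linExt (λ u → lmul u (q ++ q')) p                         ≈⟨ linExt-congᶠ p (λ u → ≡⇒≈ (linExt-++ _ q q')) ⟩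
  linExt (λ u → lmul u q ++ lmul u q') p                    ≈⟨ linExt-++ᶠ _ _ p ⟩
  linExt (λ u → lmul u q) p ++ linExt (λ u → lmul u q') p   ≈⟨ ++-cong (mul-linExt p q) (mul-linExt p q') ⟨
  mul p q ++ mul p q'                                       ∎
  where open ≈-Reasoning

mul-scaleˡ : ∀ c p q → mul (scale c p) q ≈ scale c (mul p q)
mul-scaleˡ c p q =
  ≈-trans (mul-linExt (scale c p) q) (≈-trans (linExt-scale _ c p) (scale-cong c (≈-sym (mul-linExt p q))))

mul-scaleʳ : ∀ c p q → mul p (scale c q) ≈ scale c (mul p q)
mul-scaleʳ c p q =
  ≈-trans (mul-linExt p (scale c q)) (≈-trans (linExt-congᶠ p (λ u → linExt-scale _ c q))
  (≈-trans (linExt-scaleᶠ c _ p) (scale-cong c (≈-sym (mul-linExt p q)))))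

mul-negˡ : ∀ p q → mul (neg p) q ≈ neg (mul p q)
mul-negˡ = mul-scaleˡ (- 1ℚ)

mul-negʳ : ∀ p q → mul p (neg q) ≈ neg (mul p q)
mul-negʳ = mul-scaleʳ (- 1ℚ)

mul-[]ˡ : ∀ q → mul [] q ≈ []
mul-[]ˡ q = ≈-trans (mul-linExt [] q) (≡⇒≈ (linExt-[] _))

mul-[]ʳ : ∀ p → mul p [] ≈ []
mul-[]ʳ p = ≈-trans (mul-linExt p []) (linExt-zero p (λ u → ≡⇒≈ (linExt-[] _)))

mul-wordPˡ : ∀ u q → mul (wordP u) q ≈ lmul u q
mul-wordPˡ u q = ≈-trans (mul-linExt (wordP u) q) (linExt-wordP _ u)

mul-wordP : ∀ u v → mul (wordP u) (wordP v) ≈ wordP (u ++ v)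
mul-wordP u v = ≈-trans (mul-wordPˡ u (wordP v)) (linExt-wordP _ v)

lmul-lmul : ∀ u v r → linExt (λ y → wordP (u ++ y)) (lmul v r) ≈ lmul (u ++ v) r
lmul-lmul u v r = ≈-trans (linExt-linExt _ _ r)
  (linExt-congᶠ r (λ z → ≈-trans (linExt-wordP _ (v ++ z)) (≡⇒≈ (cong wordP (sym (List.++-assoc u v z))))))

mul-assoc : ∀ p q r → mul (mul p q) r ≈ mul p (mul q r)
mul-assoc p q r = begin
  mul (mul p q) r                                                   ≈⟨ mul-linExt (mul p q) r ⟩
  linExt (λ u → lmul u r) (mul p q)                                 ≈⟨ linExt-cong _ (mul-linExt p q) ⟩
  linExt (λ u → lmul u r) (linExt (λ u → lmul u q) p)               ≈⟨ linExt-linExt _ _ p ⟩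
  linExt (λ u → linExt (λ u → lmul u r) (lmul u q)) p               ≈⟨ linExt-congᶠ p left ⟩
  linExt (λ u → linExt (λ v → lmul (u ++ v) r) q) p                 ≈⟨ linExt-congᶠ p right ⟨
  linExt (λ u → lmul u (mul q r)) p                                 ≈⟨ mul-linExt p (mul q r) ⟨
  mul p (mul q r)                                                   ∎
  where
  open ≈-Reasoning
  left : ∀ u → linExt (λ u → lmul u r) (lmul u q) ≈ linExt (λ v → lmul (u ++ v) r) q
  left u = ≈-trans (linExt-linExt _ _ q) (linExt-congᶠ q (λ v → linExt-wordP _ (u ++ v)))
  right : ∀ u → lmul u (mul q r) ≈ linExt (λ v → lmul (u ++ v) r) q
  right u = ≈-trans (linExt-cong _ (mul-linExt q r)) (≈-trans (linExt-linExt _ _ q) (linExt-congᶠ q (λ v → lmul-lmul u v r)))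

mul-oneˡ : ∀ q → mul one q ≈ q
mul-oneˡ q = ≈-trans (mul-wordPˡ [] q) (linExt-wordP-id q)

mul-oneʳ : ∀ p → mul p one ≈ p
mul-oneʳ p = ≈-trans (mul-linExt p one)
  (≈-trans (linExt-congᶠ p (λ u → ≈-trans (linExt-wordP _ []) (≡⇒≈ (cong wordP (List.++-identityʳ u))))) (linExt-wordP-id p))

mul-linExtˡ : ∀ F p q → mul (linExt F p) q ≈ linExt (λ u → mul (F u) q) p
mul-linExtˡ F p q = begin
  mul (linExt F p) q                                  ≈⟨ mul-linExt (linExt F p) q ⟩
  linExt (λ u → lmul u q) (linExt F p)                ≈⟨ linExt-linExt _ F p ⟩
  linExt (λ u → linExt (λ x → lmul x q) (F u)) p      ≈⟨ linExt-congᶠ p (λ u → mul-linExt (F u) q) ⟨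
  linExt (λ u → mul (F u) q) p                        ∎
  where open ≈-Reasoning

mul-linExtʳ : ∀ F p q → mul p (linExt F q) ≈ linExt (λ v → mul p (F v)) q
mul-linExtʳ F p q = begin
  mul p (linExt F q)                                  ≈⟨ mul-linExt p (linExt F q) ⟩
  linExt (λ u → lmul u (linExt F q)) p                ≈⟨ linExt-congᶠ p (λ u → linExt-linExt _ F q) ⟩
  linExt (λ u → linExt (λ v → lmul u (F v)) q) p      ≈⟨ linExt-swap p q (λ u v → lmul u (F v)) ⟩
  linExt (λ v → linExt (λ u → lmul u (F v)) p) q      ≈⟨ linExt-congᶠ q (λ v → mul-linExt p (F v)) ⟨
  linExt (λ v → mul p (F v)) q                        ∎
  where open ≈-Reasoning

record Linear (L : Poly → Poly) : Set where
  constructor linear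
  field
    lin-cong    : ∀ {p q} → p ≈ q → L p ≈ L q
    lin-onWords : ∀ p → L p ≈ linExt (λ u → L (wordP u)) p
open Linear public

lin-linExt : ∀ {L} → Linear L → ∀ F p → L (linExt F p) ≈ linExt (λ u → L (F u)) p
lin-linExt {L} lL F p = begin
  L (linExt F p)                                      ≈⟨ lin-onWords lL (linExt F p) ⟩
  linExt (λ u → L (wordP u)) (linExt F p)             ≈⟨ linExt-linExt _ F p ⟩
  linExt (λ u → linExt (λ x → L (wordP x)) (F u)) p   ≈⟨ linExt-congᶠ p (λ u → lin-onWords lL (F u)) ⟨
  linExt (λ u → L (F u)) p                            ∎
  where open ≈-Reasoning

lin-++ : ∀ {L} → Linear L → ∀ p q → L (p ++ q) ≈ L p ++ L q
lin-++ lL p q = ≈-trans (lin-onWords lL (p ++ q))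
  (≈-trans (≡⇒≈ (linExt-++ _ p q)) (++-cong (≈-sym (lin-onWords lL p)) (≈-sym (lin-onWords lL q))))

lin-scale : ∀ {L} → Linear L → ∀ c p → L (scale c p) ≈ scale c (L p)
lin-scale lL c p = ≈-trans (lin-onWords lL (scale c p))
  (≈-trans (linExt-scale _ c p) (scale-cong c (≈-sym (lin-onWords lL p))))

lin-neg : ∀ {L} → Linear L → ∀ p → L (neg p) ≈ neg (L p)
lin-neg lL = lin-scale lL (- 1ℚ)

lin-[] : ∀ {L} → Linear L → L [] ≈ []
lin-[] lL = ≈-trans (lin-onWords lL []) (≡⇒≈ (linExt-[] _))

lin-unique : ∀ {L L'} → Linear L → Linear L' → (∀ u → L (wordP u) ≈ L' (wordP u)) → ∀ p → L p ≈ L' p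
lin-unique lL lL' e p = ≈-trans (lin-onWords lL p) (≈-trans (linExt-congᶠ p e) (≈-sym (lin-onWords lL' p)))

scale-Linear : ∀ c → Linear (scale c)
scale-Linear c = linear (scale-cong c)
  (λ p → ≈-trans (scale-cong c (≈-sym (linExt-wordP-id p))) (≈-sym (linExt-scaleᶠ c wordP p)))

mul-Linearˡ : ∀ q → Linear (λ p → mul p q)
mul-Linearˡ q = linear (mul-congˡ q)
  (λ p → ≈-trans (mul-congˡ q (≈-sym (linExt-wordP-id p))) (mul-linExtˡ wordP p q))

mul-Linearʳ : ∀ p → Linear (mul p)
mul-Linearʳ p = linear (mul-congʳ p)
  (λ q → ≈-trans (mul-congʳ p (≈-sym (linExt-wordP-id q))) (mul-linExtʳ wordP p q))

∘-Linear : ∀ {L₁ L₂} → Linear L₁ → Linear L₂ → Linear (λ p → L₁ (L₂ p))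
∘-Linear l₁ l₂ = linear (λ e → lin-cong l₁ (lin-cong l₂ e))
  (λ p → ≈-trans (lin-cong l₁ (lin-onWords l₂ p)) (lin-linExt l₁ _ p))

++-Linear : ∀ {L₁ L₂} → Linear L₁ → Linear L₂ → Linear (λ p → L₁ p ++ L₂ p)
++-Linear l₁ l₂ = linear (λ e → ++-cong (lin-cong l₁ e) (lin-cong l₂ e))
  (λ p → ≈-trans (++-cong (lin-onWords l₁ p) (lin-onWords l₂ p)) (≈-sym (linExt-++ᶠ _ _ p)))

neg-Linear : ∀ {L} → Linear L → Linear (λ p → neg (L p))
neg-Linear l = ∘-Linear (scale-Linear (- 1ℚ)) l

bilin-unique : ∀ (B B' : Poly → Poly → Poly) →
  (∀ q → Linear (λ p → B p q)) → (∀ p → Linear (B p)) →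
  (∀ q → Linear (λ p → B' p q)) → (∀ p → Linear (B' p)) →
  (∀ u v → B (wordP u) (wordP v) ≈ B' (wordP u) (wordP v)) → ∀ p q → B p q ≈ B' p q
bilin-unique B B' l₁ l₂ l₁' l₂' e p q =
  lin-unique (l₁ q) (l₁' q) (λ u → lin-unique (l₂ (wordP u)) (l₂' (wordP u)) (e u) q) p

Σ : ∀ {A : Set} → List A → (A → Poly) → Poly
Σ [] f = []
Σ (a ∷ as) f = f a ++ Σ as f

Σ-++ : ∀ {A : Set} (xs ys : List A) f → Σ (xs ++ ys) f ≈ Σ xs f ++ Σ ys f
Σ-++ [] ys f = ≈-refl
Σ-++ (x ∷ xs) ys f = ≈-trans (++-cong ≈-refl (Σ-++ xs ys f)) (≡⇒≈ (sym (List.++-assoc (f x) (Σ xs f) (Σ ys f))))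

Σ-cong : ∀ {A : Set} (xs : List A) {f g} → (∀ a → f a ≈ g a) → Σ xs f ≈ Σ xs g
Σ-cong [] e = ≈-refl
Σ-cong (x ∷ xs) e = ++-cong (e x) (Σ-cong xs e)

Σ-map : ∀ {A B : Set} (g : A → B) xs f → Σ (map g xs) f ≡ Σ xs (λ a → f (g a))
Σ-map g [] f = refl
Σ-map g (x ∷ xs) f = cong (f (g x) ++_) (Σ-map g xs f)

Σ-concatMap : ∀ {A B : Set} (g : A → List B) xs f → Σ (concatMap g xs) f ≈ Σ xs (λ a → Σ (g a) f)
Σ-concatMap g [] f = ≈-refl
Σ-concatMap g (x ∷ xs) f = ≈-trans (Σ-++ (g x) (concatMap g xs) f) (++-cong ≈-refl (Σ-concatMap g xs f))

concatMap≡Σ : ∀ {A : Set} (F : A → Poly) xs → concatMap F xs ≡ Σ xs F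
concatMap≡Σ F [] = refl
concatMap≡Σ F (a ∷ xs) = cong (F a ++_) (concatMap≡Σ F xs)

Σ-++ᶠ : ∀ {A : Set} (xs : List A) f g → Σ xs (λ a → f a ++ g a) ≈ Σ xs f ++ Σ xs g
Σ-++ᶠ [] f g = ≈-refl
Σ-++ᶠ (x ∷ xs) f g = ≈-trans (++-cong ≈-refl (Σ-++ᶠ xs f g)) (interchange (f x) (g x) (Σ xs f) (Σ xs g))

Σ-zero : ∀ {A : Set} (xs : List A) {f} → (∀ a → f a ≈ []) → Σ xs f ≈ []
Σ-zero [] e = ≈-refl
Σ-zero (x ∷ xs) e = ++-cong (e x) (Σ-zero xs e)

lin-Σ : ∀ {A : Set} {L} → Linear L → (xs : List A) → ∀ f → L (Σ xs f) ≈ Σ xs (λ a → L (f a))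
lin-Σ lL [] f = lin-[] lL
lin-Σ lL (x ∷ xs) f = ≈-trans (lin-++ lL (f x) (Σ xs f)) (++-cong ≈-refl (lin-Σ lL xs f))

Σ-swap : ∀ {A B : Set} (xs : List A) (ys : List B) (f : A → B → Poly) →
  Σ xs (λ a → Σ ys (f a)) ≈ Σ ys (λ b → Σ xs (λ a → f a b))
Σ-swap [] ys f = ≈-sym (Σ-zero ys (λ b → ≈-refl))
Σ-swap (x ∷ xs) ys f =
  ≈-trans (++-cong {Σ ys (f x)} ≈-refl (Σ-swap xs ys f)) (≈-sym (Σ-++ᶠ ys (f x) (λ b → Σ xs (λ a → f a b))))

Σ-mulˡ : ∀ {A : Set} (xs : List A) f q → mul (Σ xs f) q ≈ Σ xs (λ a → mul (f a) q)
Σ-mulˡ xs f q = lin-Σ (mul-Linearˡ q) xs f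

Σ-mulʳ : ∀ {A : Set} p (xs : List A) f → mul p (Σ xs f) ≈ Σ xs (λ a → mul p (f a))
Σ-mulʳ p xs f = lin-Σ (mul-Linearʳ p) xs f

Σ-neg : ∀ {A : Set} (xs : List A) f → neg (Σ xs f) ≈ Σ xs (λ a → neg (f a))
Σ-neg = lin-Σ (scale-Linear (- 1ℚ))

Σw : ∀ {A : Set} → List (ℚ × A) → (A → Poly) → Poly
Σw L f = Σ L (λ ca → scale (proj₁ ca) (f (proj₂ ca)))

Σw-cong : ∀ {A : Set} (L : List (ℚ × A)) {f g} → (∀ a → f a ≈ g a) → Σw L f ≈ Σw L g
Σw-cong L e = Σ-cong L (λ ca → scale-cong (proj₁ ca) (e (proj₂ ca)))

lin-Σw : ∀ {A : Set} {L} → Linear L → (W : List (ℚ × A)) → ∀ f → L (Σw W f) ≈ Σw W (λ a → L (f a))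
lin-Σw lL W f = ≈-trans (lin-Σ lL W _) (Σ-cong W (λ ca → lin-scale lL (proj₁ ca) (f (proj₂ ca))))

Σw-++ᶠ : ∀ {A : Set} (L : List (ℚ × A)) f g → Σw L (λ a → f a ++ g a) ≈ Σw L f ++ Σw L g
Σw-++ᶠ L f g = ≈-trans (Σ-cong L (λ ca → ≡⇒≈ (scale-++ (proj₁ ca) (f (proj₂ ca)) (g (proj₂ ca))))) (Σ-++ᶠ L _ _)

Σw-zero : ∀ {A : Set} (L : List (ℚ × A)) {f} → (∀ a → f a ≈ []) → Σw L f ≈ []
Σw-zero L e = Σ-zero L (λ ca → scale-cong (proj₁ ca) (e (proj₂ ca)))

Σw-map : ∀ {A B : Set} (g : A → B) (L : List (ℚ × A)) f →
  Σw (map (λ ca → (proj₁ ca , g (proj₂ ca))) L) f ≡ Σw L (λ a → f (g a))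
Σw-map g L f = Σ-map _ L _

Σw-Σ : ∀ {A B : Set} (L : List (ℚ × A)) (xs : List B) (f : A → B → Poly) →
  Σw L (λ a → Σ xs (f a)) ≈ Σ xs (λ b → Σw L (λ a → f a b))
Σw-Σ L xs f = ≈-trans (Σ-cong L (λ ca → lin-Σ (scale-Linear (proj₁ ca)) xs (f (proj₂ ca)))) (Σ-swap L xs _)

deshuffles : ∀ {A : Set} → List A → List (List A × List A)
deshuffles [] = ([] , []) ∷ []
deshuffles (x ∷ w) =
  concatMap (λ lr → (x ∷ proj₁ lr , proj₂ lr) ∷ (proj₁ lr , x ∷ proj₂ lr) ∷ []) (deshuffles w)

deshuffle≡deshuffles : ∀ V₀ w → deshuffle V₀ w ≡ deshuffles w
deshuffle≡deshuffles V₀ [] = refl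
deshuffle≡deshuffles V₀ (x ∷ w) rewrite deshuffle≡deshuffles V₀ w = refl

Σ-deshuffles : ∀ {A : Set} x (w : List A) f →
  Σ (deshuffles (x ∷ w)) f ≈ Σ (deshuffles w) (λ lr → f (x ∷ proj₁ lr , proj₂ lr) ++ f (proj₁ lr , x ∷ proj₂ lr))
Σ-deshuffles x w f = ≈-trans (Σ-concatMap _ (deshuffles w) f)
  (Σ-cong (deshuffles w) (λ lr → ++-cong {f (x ∷ proj₁ lr , proj₂ lr)} ≈-refl (++-[] (f (proj₁ lr , x ∷ proj₂ lr)))))

Σ-deshuffles-map : ∀ {A B : Set} (f : A → B) (r : List A) (F : List B × List B → Poly) →
  Σ (deshuffles (map f r)) F ≈ Σ (deshuffles r) (λ I → F (map f (proj₁ I) , map f (proj₂ I)))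
Σ-deshuffles-map f [] F = ≈-refl
Σ-deshuffles-map f (y ∷ r) F = ≈-trans (Σ-deshuffles (f y) (map f r) F)
  (≈-trans (Σ-deshuffles-map f r _) (≈-sym (Σ-deshuffles y r (λ I → F (map f (proj₁ I) , map f (proj₂ I))))))

deshuffles-coassoc : ∀ {A : Set} (u : List A) (F : List A → List A → List A → Poly) →
  Σ (deshuffles u) (λ I → Σ (deshuffles (proj₂ I)) (λ J → F (proj₁ I) (proj₁ J) (proj₂ J))) ≈
  Σ (deshuffles u) (λ I → Σ (deshuffles (proj₁ I)) (λ J → F (proj₁ J) (proj₂ J) (proj₂ I)))
deshuffles-coassoc [] F = ≈-refl
deshuffles-coassoc {A} (y ∷ u) F = begin
  Σ (deshuffles (y ∷ u)) (λ I → Σ (deshuffles (proj₂ I)) (λ J → F (proj₁ I) (proj₁ J) (proj₂ J)))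
    ≈⟨ Σ-deshuffles y u _ ⟩
  Σ (deshuffles u) (λ I → Σ (deshuffles (proj₂ I)) (λ J → F (y ∷ proj₁ I) (proj₁ J) (proj₂ J))
                          ++ Σ (deshuffles (y ∷ proj₂ I)) (λ J → F (proj₁ I) (proj₁ J) (proj₂ J)))
    ≈⟨ Σ-cong (deshuffles u) (λ I → ≈-trans (++-cong ≈-refl (Σ-deshuffles y (proj₂ I) _))
                                            (≈-sym (Σ-++ᶠ (deshuffles (proj₂ I)) _ _))) ⟩
  Σ (deshuffles u) (λ I → Σ (deshuffles (proj₂ I)) (λ J → F' (proj₁ I) (proj₁ J) (proj₂ J)))
    ≈⟨ deshuffles-coassoc u F' ⟩
  Σ (deshuffles u) (λ I → Σ (deshuffles (proj₁ I)) (λ J → F' (proj₁ J) (proj₂ J) (proj₂ I)))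
    ≈⟨ Σ-cong (deshuffles u) (λ I → ≈-trans (Σ-cong (deshuffles (proj₁ I)) (λ J → ≡⇒≈ (sym (List.++-assoc (F (y ∷ proj₁ J) (proj₂ J) (proj₂ I)) _ _))))
          (≈-trans (Σ-++ᶠ (deshuffles (proj₁ I)) _ _) (++-cong (≈-sym (Σ-deshuffles y (proj₁ I) _)) ≈-refl))) ⟩
  Σ (deshuffles u) (λ I → Σ (deshuffles (y ∷ proj₁ I)) (λ J → F (proj₁ J) (proj₂ J) (proj₂ I))
                          ++ Σ (deshuffles (proj₁ I)) (λ J → F (proj₁ J) (proj₂ J) (y ∷ proj₂ I)))
    ≈⟨ Σ-deshuffles y u _ ⟨
  Σ (deshuffles (y ∷ u)) (λ I → Σ (deshuffles (proj₁ I)) (λ J → F (proj₁ J) (proj₂ J) (proj₂ I)))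
    ∎
  where
  open ≈-Reasoning
  F' : List A → List A → List A → Poly
  F' l a b = F (y ∷ l) a b ++ (F l (y ∷ a) b ++ F l a (y ∷ b))

δ : Word → Word → ℚ
δ u w = if wordEq u w then 1ℚ else 0ℚ

coeff-pair : ∀ p w → coeff p w ≡ pair p (λ u → δ u w)
coeff-pair [] w = refl
coeff-pair ((c , u) ∷ p) w = cong₂ _+_ (trans (cong (λ d → if wordEq u w then d else 0ℚ) (sym (*-identityʳ c)))
                                              (if-*ʳ (wordEq u w) c 1ℚ))
                                       (coeff-pair p w)

coeff-Σ : ∀ {A : Set} (xs : List A) F w → coeff (Σ xs F) w ≡ Σq xs (λ a → coeff (F a) w)
coeff-Σ [] F w = refl
coeff-Σ (x ∷ xs) F w = trans (coeff-++ (F x) (Σ xs F) w) (cong (coeff (F x) w +_) (coeff-Σ xs F w))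

coeff-concatMap : ∀ {A : Set} (f : A → Poly) xs w → coeff (concatMap f xs) w ≡ Σq xs (λ a → coeff (f a) w)
coeff-concatMap f xs w = trans (cong (λ p → coeff p w) (concatMap≡Σ f xs)) (coeff-Σ xs f w)

when : Bool → ℚ → ℚ
when b e = if b then e else 0ℚ

when-*ˡ : ∀ b e g → when b e * g ≡ when b (e * g)
when-*ˡ true e g = refl
when-*ˡ false e g = *-zeroˡ g

when-*ʳ : ∀ b e g → g * when b e ≡ when b (g * e)
when-*ʳ true e g = refl
when-*ʳ false e g = *-zeroʳ g

Σq-when : ∀ {A : Set} b (xs : List A) f → Σq xs (λ a → when b (f a)) ≡ when b (Σq xs f)
Σq-when true xs f = refl
Σq-when false xs f = Σq-zero xs (λ a → refl)

when-cong : ∀ b {e e'} → (b ≡ true → e ≡ e') → when b e ≡ when b e'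
when-cong true h = h refl
when-cong false h = refl

δ-∷ : ∀ a b u w → δ (a ∷ u) (b ∷ w) ≡ when (a ≡ᵇ b) (δ u w)
δ-∷ a b u w with a ≡ᵇ b
... | true = refl
... | false = refl

ifHead : Letter → Word → (Word → ℚ) → ℚ
ifHead z [] f = 0ℚ
ifHead z (a ∷ x) f = when (a ≡ᵇ z) (f x)

δ-∷ʳ : ∀ x z w → δ x (z ∷ w) ≡ ifHead z x (λ x' → δ x' w)
δ-∷ʳ [] z w = refl
δ-∷ʳ (a ∷ x) z w = δ-∷ a z x w

ifHead-cong : ∀ z x {f g} → (∀ x' → f x' ≡ g x') → ifHead z x f ≡ ifHead z x g
ifHead-cong z [] e = refl
ifHead-cong z (a ∷ x) e = cong (when (a ≡ᵇ z)) (e x)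

ifHead-*ˡ : ∀ z x f c → ifHead z x f * c ≡ ifHead z x (λ x' → f x' * c)
ifHead-*ˡ z [] f c = *-zeroˡ c
ifHead-*ˡ z (a ∷ x) f c = when-*ˡ (a ≡ᵇ z) (f x) c

ifHead-*ʳ : ∀ z x f c → c * ifHead z x f ≡ ifHead z x (λ x' → c * f x')
ifHead-*ʳ z [] f c = *-zeroʳ c
ifHead-*ʳ z (a ∷ x) f c = when-*ʳ (a ≡ᵇ z) (f x) c

Σq-ifHead : ∀ {A : Set} z x (xs : List A) (f : A → Word → ℚ) → Σq xs (λ a → ifHead z x (f a)) ≡ ifHead z x (λ x' → Σq xs (λ a → f a x'))
Σq-ifHead z [] xs f = Σq-zero xs (λ a → refl)
Σq-ifHead z (a ∷ x) xs f = Σq-when (a ≡ᵇ z) xs (λ b → f b x)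

Σq-deshuffles : ∀ {A : Set} z (w : List A) f →
  Σq (deshuffles (z ∷ w)) f ≡ Σq (deshuffles w) (λ J → f (z ∷ proj₁ J , proj₂ J) + f (proj₁ J , z ∷ proj₂ J))
Σq-deshuffles z w f = trans (Σq-concatMap _ (deshuffles w) f)
  (Σq-cong (deshuffles w) (λ J → cong (f (z ∷ proj₁ J , proj₂ J) +_) (+-identityʳ _)))

-- Duality of the shuffle product and the deshuffle coproduct.

shuffleCount : Word → Word → Word → ℚ
shuffleCount u x y = Σq (shuffleW x y) (λ s → δ s u)

deshuffleCount : Word → Word → Word → ℚ
deshuffleCount u x y = Σq (deshuffles u) (λ J → δ x (proj₁ J) * δ y (proj₂ J))

shuffleW-[]ʳ : ∀ x → shuffleW x [] ≡ x ∷ []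
shuffleW-[]ʳ [] = refl
shuffleW-[]ʳ (_ ∷ _) = refl

shuffleCount-[] : ∀ x y → shuffleCount [] x y ≡ δ x [] * δ y []
shuffleCount-[] [] y = trans (+-identityʳ (δ y [])) (sym (*-identityˡ (δ y [])))
shuffleCount-[] (a ∷ x) [] = trans (+-identityʳ 0ℚ) (sym (*-zeroˡ 1ℚ))
shuffleCount-[] (a ∷ x) (b ∷ y) = begin
  Σq (map (a ∷_) (shuffleW x (b ∷ y)) ++ map (b ∷_) (shuffleW (a ∷ x) y)) (λ s → δ s [])
    ≡⟨ Σq-++ (map (a ∷_) (shuffleW x (b ∷ y))) _ _ ⟩
  Σq (map (a ∷_) (shuffleW x (b ∷ y))) (λ s → δ s []) + Σq (map (b ∷_) (shuffleW (a ∷ x) y)) (λ s → δ s [])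
    ≡⟨ cong₂ _+_ (trans (Σq-map _ (shuffleW x (b ∷ y)) _) (Σq-zero (shuffleW x (b ∷ y)) (λ _ → refl)))
                 (trans (Σq-map _ (shuffleW (a ∷ x) y) _) (Σq-zero (shuffleW (a ∷ x) y) (λ _ → refl))) ⟩
  0ℚ + 0ℚ
    ≡⟨ trans (+-identityˡ 0ℚ) (sym (*-zeroˡ 0ℚ)) ⟩
  0ℚ * 0ℚ ∎
  where open ≡-Reasoning

shuffleCount-∷ : ∀ z u x y → shuffleCount (z ∷ u) x y ≡
  ifHead z x (λ x' → shuffleCount u x' y) + ifHead z y (λ y' → shuffleCount u x y')
shuffleCount-∷ z u [] y =
  trans (+-identityʳ _) (trans (δ-∷ʳ y z u) (trans (ifHead-cong z y (λ y' → sym (+-identityʳ _))) (sym (+-identityˡ _))))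
shuffleCount-∷ z u (a ∷ x) [] =
  trans (+-identityʳ _) (trans (δ-∷ a z x u) (trans (cong (when (a ≡ᵇ z)) (sym count-x)) (sym (+-identityʳ _))))
  where
  count-x : shuffleCount u x [] ≡ δ x u
  count-x = trans (cong (λ S → Σq S (λ s → δ s u)) (shuffleW-[]ʳ x)) (+-identityʳ _)
shuffleCount-∷ z u (a ∷ x) (b ∷ y) =
  trans (Σq-++ (map (a ∷_) (shuffleW x (b ∷ y))) _ _) (cong₂ _+_ (headed a (shuffleW x (b ∷ y))) (headed b (shuffleW (a ∷ x) y)))
  where
  headed : ∀ c S → Σq (map (c ∷_) S) (λ s → δ s (z ∷ u)) ≡ when (c ≡ᵇ z) (Σq S (λ s → δ s u))
  headed c S = trans (Σq-map _ S _) (trans (Σq-cong S (λ s → δ-∷ c z s u)) (Σq-when (c ≡ᵇ z) S _))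

deshuffleCount-∷ : ∀ z u x y → deshuffleCount (z ∷ u) x y ≡
  ifHead z x (λ x' → deshuffleCount u x' y) + ifHead z y (λ y' → deshuffleCount u x y')
deshuffleCount-∷ z u x y = begin
  deshuffleCount (z ∷ u) x y
    ≡⟨ trans (Σq-deshuffles z u _) (Σq-+ (deshuffles u) _ _) ⟩
  Σq (deshuffles u) (λ J → δ x (z ∷ proj₁ J) * δ y (proj₂ J)) + Σq (deshuffles u) (λ J → δ x (proj₁ J) * δ y (z ∷ proj₂ J))
    ≡⟨ cong₂ _+_ (Σq-cong (deshuffles u) (λ J → trans (cong (_* δ y (proj₂ J)) (δ-∷ʳ x z (proj₁ J))) (ifHead-*ˡ z x (λ x' → δ x' (proj₁ J)) (δ y (proj₂ J)))))
                 (Σq-cong (deshuffles u) (λ J → trans (cong (δ x (proj₁ J) *_) (δ-∷ʳ y z (proj₂ J))) (ifHead-*ʳ z y (λ y' → δ y' (proj₂ J)) (δ x (proj₁ J))))) ⟩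
  Σq (deshuffles u) (λ J → ifHead z x (λ x' → δ x' (proj₁ J) * δ y (proj₂ J)))
    + Σq (deshuffles u) (λ J → ifHead z y (λ y' → δ x (proj₁ J) * δ y' (proj₂ J)))
    ≡⟨ cong₂ _+_ (Σq-ifHead z x (deshuffles u) (λ J x' → δ x' (proj₁ J) * δ y (proj₂ J)))
                 (Σq-ifHead z y (deshuffles u) (λ J y' → δ x (proj₁ J) * δ y' (proj₂ J))) ⟩
  ifHead z x (λ x' → deshuffleCount u x' y) + ifHead z y (λ y' → deshuffleCount u x y') ∎
  where open ≡-Reasoning

shuffleCount≡deshuffleCount : ∀ u x y → shuffleCount u x y ≡ deshuffleCount u x y
shuffleCount≡deshuffleCount [] x y = trans (shuffleCount-[] x y) (sym (+-identityʳ _))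
shuffleCount≡deshuffleCount (z ∷ u) x y =
  trans (shuffleCount-∷ z u x y)
  (trans (cong₂ _+_ (ifHead-cong z x (λ x' → shuffleCount≡deshuffleCount u x' y))
                    (ifHead-cong z y (λ y' → shuffleCount≡deshuffleCount u x y')))
         (sym (deshuffleCount-∷ z u x y)))

coeff-shP : ∀ P Q u → coeff (shP P Q) u ≡ Σq (deshuffles u) (λ J → coeff P (proj₁ J) * coeff Q (proj₂ J))
coeff-shP P Q u = begin
  coeff (shP P Q) u
    ≡⟨ coeff-concatMap _ P u ⟩
  Σq P (λ cx → coeff (concatMap (λ dy → shuffled cx dy) Q) u)
    ≡⟨ Σq-cong P (λ cx → trans (coeff-concatMap _ Q u) (Σq-cong Q (λ dy → coeff-shuffled cx dy))) ⟩
  Σq P (λ cx → Σq Q (λ dy → proj₁ cx * proj₁ dy * deshuffleCount u (proj₂ cx) (proj₂ dy)))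
    ≡⟨ Σq-cong P (λ cx → Σq-cong Q (λ dy → sym (Σq-*ˡ (proj₁ cx * proj₁ dy) (deshuffles u) _))) ⟩
  Σq P (λ cx → Σq Q (λ dy → Σq (deshuffles u) (λ J → proj₁ cx * proj₁ dy * (δ (proj₂ cx) (proj₁ J) * δ (proj₂ dy) (proj₂ J)))))
    ≡⟨ Σq-cong P (λ cx → Σq-cong Q (λ dy → Σq-cong (deshuffles u) (λ J → lem (proj₁ cx) (proj₁ dy) _ _))) ⟩
  Σq P (λ cx → Σq Q (λ dy → Σq (deshuffles u) (λ J → proj₁ cx * δ (proj₂ cx) (proj₁ J) * (proj₁ dy * δ (proj₂ dy) (proj₂ J)))))
    ≡⟨ Σq-cong P (λ cx → Σq-swap Q (deshuffles u) _) ⟩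
  Σq P (λ cx → Σq (deshuffles u) (λ J → Σq Q (λ dy → proj₁ cx * δ (proj₂ cx) (proj₁ J) * (proj₁ dy * δ (proj₂ dy) (proj₂ J)))))
    ≡⟨ Σq-swap P (deshuffles u) _ ⟩
  Σq (deshuffles u) (λ J → Σq P (λ cx → Σq Q (λ dy → proj₁ cx * δ (proj₂ cx) (proj₁ J) * (proj₁ dy * δ (proj₂ dy) (proj₂ J)))))
    ≡⟨ Σq-cong (deshuffles u) (λ J → sym (trans (cong₂ _*_ (coeff-pair P (proj₁ J)) (coeff-pair Q (proj₂ J))) (Σq-* P Q _ _))) ⟩
  Σq (deshuffles u) (λ J → coeff P (proj₁ J) * coeff Q (proj₂ J)) ∎
  where
  open ≡-Reasoning
  shuffled : ℚ × Word → ℚ × Word → Poly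
  shuffled (c , x) (d , y) = map (λ s → (c * d , s)) (shuffleW x y)
  coeff-weighted : ∀ k S → coeff (map (λ s → (k , s)) S) u ≡ k * Σq S (λ s → δ s u)
  coeff-weighted k [] = sym (*-zeroʳ k)
  coeff-weighted k (s ∷ S) =
    trans (cong₂ _+_ (trans (cong (λ d → if wordEq s u then d else 0ℚ) (sym (*-identityʳ k))) (if-*ʳ (wordEq s u) k 1ℚ))
                     (coeff-weighted k S))
          (sym (*-distribˡ-+ k (δ s u) _))
  coeff-shuffled : ∀ cx dy → coeff (shuffled cx dy) u ≡ proj₁ cx * proj₁ dy * deshuffleCount u (proj₂ cx) (proj₂ dy)
  coeff-shuffled (c , x) (d , y) =
    trans (coeff-weighted (c * d) (shuffleW x y)) (cong (c * d *_) (shuffleCount≡deshuffleCount u x y))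
  lem : ∀ c d a b → c * d * (a * b) ≡ c * a * (d * b)
  lem = solveℚ 4 (λ c d a b → c :* d :* (a :* b) := c :* a :* (d :* b)) refl

splittings : Word → List (Word × Word)
splittings [] = ([] , []) ∷ []
splittings (z ∷ w) = ([] , z ∷ w) ∷ map (λ s → (z ∷ proj₁ s , proj₂ s)) (splittings w)

splittings-δ : ∀ w p q → Σq (splittings w) (λ s → δ p (proj₁ s) * δ q (proj₂ s)) ≡ δ (p ++ q) w
splittings-δ [] [] q = trans (+-identityʳ _) (*-identityˡ (δ q []))
splittings-δ [] (a ∷ p) q = trans (+-identityʳ _) (*-zeroˡ (δ q []))
splittings-δ (z ∷ w) [] q = begin
  1ℚ * δ q (z ∷ w) + Σq (map _ (splittings w)) (λ s → δ [] (proj₁ s) * δ q (proj₂ s))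
    ≡⟨ cong₂ _+_ (*-identityˡ (δ q (z ∷ w))) (trans (Σq-map _ (splittings w) _) (Σq-zero (splittings w) (λ s → *-zeroˡ (δ q (proj₂ s))))) ⟩
  δ q (z ∷ w) + 0ℚ
    ≡⟨ +-identityʳ _ ⟩
  δ q (z ∷ w) ∎
  where open ≡-Reasoning
splittings-δ (z ∷ w) (a ∷ p) q = begin
  0ℚ * δ q (z ∷ w) + Σq (map _ (splittings w)) (λ s → δ (a ∷ p) (proj₁ s) * δ q (proj₂ s))
    ≡⟨ cong₂ _+_ (*-zeroˡ (δ q (z ∷ w))) (Σq-map _ (splittings w) _) ⟩
  0ℚ + Σq (splittings w) (λ s → δ (a ∷ p) (z ∷ proj₁ s) * δ q (proj₂ s))
    ≡⟨ +-identityˡ _ ⟩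
  Σq (splittings w) (λ s → δ (a ∷ p) (z ∷ proj₁ s) * δ q (proj₂ s))
    ≡⟨ Σq-cong (splittings w) (λ s → trans (cong (_* δ q (proj₂ s)) (δ-∷ a z p (proj₁ s))) (when-*ˡ (a ≡ᵇ z) _ _)) ⟩
  Σq (splittings w) (λ s → when (a ≡ᵇ z) (δ p (proj₁ s) * δ q (proj₂ s)))
    ≡⟨ Σq-when (a ≡ᵇ z) (splittings w) _ ⟩
  when (a ≡ᵇ z) (Σq (splittings w) (λ s → δ p (proj₁ s) * δ q (proj₂ s)))
    ≡⟨ cong (when (a ≡ᵇ z)) (splittings-δ w p q) ⟩
  when (a ≡ᵇ z) (δ (p ++ q) w)
    ≡⟨ δ-∷ a z (p ++ q) w ⟨
  δ (a ∷ p ++ q) (z ∷ w) ∎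
  where open ≡-Reasoning

coeff-mul : ∀ P Q w → coeff (mul P Q) w ≡ Σq (splittings w) (λ s → coeff P (proj₁ s) * coeff Q (proj₂ s))
coeff-mul P Q w = begin
  coeff (mul P Q) w
    ≡⟨ at (mul-linExt P Q) w ⟩
  coeff (linExt (λ p → lmul p Q) P) w
    ≡⟨ coeff-linExt _ P w ⟩
  pair P (λ p → coeff (lmul p Q) w)
    ≡⟨ pair-congᶠ P (λ p → trans (coeff-linExt _ Q w) (pair-congᶠ Q (λ q → trans (coeff-wordP (p ++ q) w) (sym (splittings-δ w p q))))) ⟩
  pair P (λ p → pair Q (λ q → Σq (splittings w) (λ s → δ p (proj₁ s) * δ q (proj₂ s))))
    ≡⟨ pair-congᶠ P (λ p → pair-Σq Q (splittings w) _) ⟩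
  pair P (λ p → Σq (splittings w) (λ s → pair Q (λ q → δ p (proj₁ s) * δ q (proj₂ s))))
    ≡⟨ pair-congᶠ P (λ p → Σq-cong (splittings w) (λ s → pair-* Q (δ p (proj₁ s)) _)) ⟩
  pair P (λ p → Σq (splittings w) (λ s → δ p (proj₁ s) * pair Q (λ q → δ q (proj₂ s))))
    ≡⟨ Σq-cong P (λ cp → trans (sym (Σq-*ˡ (proj₁ cp) (splittings w) _)) (Σq-cong (splittings w) (λ s → sym (*-assoc (proj₁ cp) _ _)))) ⟩
  Σq P (λ cp → Σq (splittings w) (λ s → proj₁ cp * δ (proj₂ cp) (proj₁ s) * pair Q (λ q → δ q (proj₂ s))))
    ≡⟨ Σq-swap P (splittings w) _ ⟩
  Σq (splittings w) (λ s → Σq P (λ cp → proj₁ cp * δ (proj₂ cp) (proj₁ s) * pair Q (λ q → δ q (proj₂ s))))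
    ≡⟨ Σq-cong (splittings w) (λ s → trans (Σq-*ʳ _ P _) (sym (cong₂ _*_ (coeff-pair P (proj₁ s)) (coeff-pair Q (proj₂ s))))) ⟩
  Σq (splittings w) (λ s → coeff P (proj₁ s) * coeff Q (proj₂ s)) ∎
  where open ≡-Reasoning

letter : Letter → Poly
letter x = wordP (x ∷ [])

letterSplittings : Word → List (Word × Letter × Word)
letterSplittings [] = []
letterSplittings (x ∷ a) = ([] , x , a) ∷ map (λ s → (x ∷ proj₁ s , proj₂ s)) (letterSplittings a)

Σq-splittings-nonempty : ∀ w (h : Word → Word → ℚ) → (∀ a → h a [] ≡ 0ℚ) →
  Σq (splittings w) (λ s → h (proj₁ s) (proj₂ s)) ≡
  Σq (letterSplittings w) (λ s → h (proj₁ s) (proj₁ (proj₂ s) ∷ proj₂ (proj₂ s)))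
Σq-splittings-nonempty [] h z = trans (+-identityʳ _) (z [])
Σq-splittings-nonempty (x ∷ w) h z = cong (h [] (x ∷ w) +_)
  (trans (Σq-map _ (splittings w) _)
  (trans (Σq-splittings-nonempty w (λ a b → h (x ∷ a) b) (λ a → z (x ∷ a))) (sym (Σq-map _ (letterSplittings w) _))))

Σq-splittings-[] : ∀ s (g : Word → ℚ) → Σq (splittings s) (λ t → δ [] (proj₁ t) * g (proj₂ t)) ≡ g s
Σq-splittings-[] [] g = trans (+-identityʳ _) (*-identityˡ (g []))
Σq-splittings-[] (z ∷ s) g = trans (cong₂ _+_ (*-identityˡ (g (z ∷ s)))
  (trans (Σq-map _ (splittings s) _) (Σq-zero (splittings s) (λ t → *-zeroˡ (g (proj₂ t)))))) (+-identityʳ _)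

coeff-letter-mul-[] : ∀ y Q → coeff (mul (letter y) Q) [] ≡ 0ℚ
coeff-letter-mul-[] y Q =
  trans (coeff-mul (letter y) Q []) (trans (+-identityʳ _) (*-zeroˡ (coeff Q [])))

coeff-letter-mul-∷ : ∀ y Q z s → coeff (mul (letter y) Q) (z ∷ s) ≡ when (y ≡ᵇ z) (coeff Q s)
coeff-letter-mul-∷ y Q z s = begin
  coeff (mul (letter y) Q) (z ∷ s)
    ≡⟨ coeff-mul (letter y) Q (z ∷ s) ⟩
  coeff (letter y) [] * coeff Q (z ∷ s) + Σq (map _ (splittings s)) (λ t → coeff (letter y) (proj₁ t) * coeff Q (proj₂ t))
    ≡⟨ cong₂ _+_ (*-zeroˡ (coeff Q (z ∷ s))) (Σq-map _ (splittings s) _) ⟩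
  0ℚ + Σq (splittings s) (λ t → coeff (letter y) (z ∷ proj₁ t) * coeff Q (proj₂ t))
    ≡⟨ trans (+-identityˡ _) (Σq-cong (splittings s) (λ t → trans (cong (_* coeff Q (proj₂ t)) (trans (coeff-wordP (y ∷ []) (z ∷ proj₁ t)) (δ-∷ y z [] (proj₁ t))))
                                                                  (when-*ˡ (y ≡ᵇ z) (δ [] (proj₁ t)) (coeff Q (proj₂ t))))) ⟩
  Σq (splittings s) (λ t → when (y ≡ᵇ z) (δ [] (proj₁ t) * coeff Q (proj₂ t)))
    ≡⟨ trans (Σq-when (y ≡ᵇ z) (splittings s) _) (cong (when (y ≡ᵇ z)) (Σq-splittings-[] s (coeff Q))) ⟩
  when (y ≡ᵇ z) (coeff Q s) ∎
  where open ≡-Reasoning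

coeff-mul-letter-mul : ∀ P y Q w → coeff (mul P (mul (letter y) Q)) w ≡
  Σq (letterSplittings w) (λ s → when (y ≡ᵇ proj₁ (proj₂ s)) (coeff P (proj₁ s) * coeff Q (proj₂ (proj₂ s))))
coeff-mul-letter-mul P y Q w =
  trans (coeff-mul P _ w)
  (trans (Σq-splittings-nonempty w (λ a b → coeff P a * coeff (mul (letter y) Q) b)
                                   (λ a → trans (cong (coeff P a *_) (coeff-letter-mul-[] y Q)) (*-zeroʳ (coeff P a))))
  (Σq-cong (letterSplittings w) (λ s → trans (cong (coeff P (proj₁ s) *_) (coeff-letter-mul-∷ y Q (proj₁ (proj₂ s)) (proj₂ (proj₂ s))))
                                             (when-*ʳ (y ≡ᵇ proj₁ (proj₂ s)) _ (coeff P (proj₁ s))))))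

coeff-antipodeW-sym : ∀ f w → coeff (antipodeW f) w ≡ coeff (antipodeW w) f
coeff-antipodeW-sym f w with wordEq (reverse f) w in e
... | true rewrite sym (wordEq-sound (reverse f) w e) | List.reverse-involutive f | wordEq-refl f | List.length-reverse f = refl
... | false rewrite sym (wordEq-reverse f w) | e = refl

coeff-constW-sym : ∀ f w → coeff (constW f) w ≡ coeff (constW w) f
coeff-constW-sym [] [] = refl
coeff-constW-sym [] (_ ∷ _) = refl
coeff-constW-sym (_ ∷ _) [] = refl
coeff-constW-sym (_ ∷ _) (_ ∷ _) = refl

coeff-Ifun-sym : ∀ b f b' w → coeff (Ifun b f b') w ≡ coeff (Ifun b w b') f
coeff-Ifun-sym false f true w = cong (_+ 0ℚ) (cong (λ b → if b then 1ℚ else 0ℚ) (wordEq-sym f w))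
coeff-Ifun-sym true f false w = coeff-antipodeW-sym f w
coeff-Ifun-sym false f false w = coeff-constW-sym f w
coeff-Ifun-sym true f true w = coeff-constW-sym f w

antipodeW≈ : ∀ p → antipodeW p ≈ scale (signOf (length p)) (wordP (reverse p))
antipodeW≈ p = ≈i λ w → cong (_+ 0ℚ) (h (wordEq (reverse p) w))
  where
  h : ∀ b → (if b then signOf (length p) else 0ℚ) ≡ (if b then signOf (length p) * 1ℚ else 0ℚ)
  h true = sym (*-identityʳ _)
  h false = refl

antipodeW-∷ : ∀ y p → antipodeW (y ∷ p) ≈ neg (mul (antipodeW p) (letter y))
antipodeW-∷ y p = begin
  antipodeW (y ∷ p)                               ≈⟨ antipodeW≈ (y ∷ p) ⟩
  scale (- sg) (wordP (reverse (y ∷ p)))          ≡⟨ cong (λ w → scale (- sg) (wordP w)) (List.unfold-reverse y p) ⟩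
  scale (- sg) (wordP (reverse p ++ y ∷ []))      ≈⟨ scale-neg sg (wordP (reverse p ++ y ∷ [])) ⟩
  scale sg (neg (wordP (reverse p ++ y ∷ [])))    ≈⟨ scale-neg-comm sg (wordP (reverse p ++ y ∷ [])) ⟩
  neg (scale sg (wordP (reverse p ++ y ∷ [])))    ≈⟨ neg-cong (scale-cong sg (mul-wordP (reverse p) (y ∷ []))) ⟨
  neg (scale sg (mul (wordP (reverse p)) (letter y)))  ≈⟨ neg-cong (mul-scaleˡ sg (wordP (reverse p)) (letter y)) ⟨
  neg (mul (scale sg (wordP (reverse p))) (letter y))  ≈⟨ neg-cong (mul-congˡ (letter y) (antipodeW≈ p)) ⟨
  neg (mul (antipodeW p) (letter y))              ∎
  where
  open ≈-Reasoning
  sg = signOf (length p)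

-- The defining property of the antipode: id ⋆ S is the counit.
antipode-convolution : ∀ n → Σ (deshuffles n) (λ I → mul (wordP (proj₁ I)) (antipodeW (proj₂ I))) ≈ constW n
antipode-convolution [] = ≈-trans (++-[] _) (mul-oneˡ (antipodeW []))
antipode-convolution (y ∷ n) = begin
  Σ (deshuffles (y ∷ n)) G
    ≈⟨ Σ-deshuffles y n G ⟩
  Σ (deshuffles n) (λ I → mul (wordP (y ∷ proj₁ I)) (antipodeW (proj₂ I)) ++ mul (wordP (proj₁ I)) (antipodeW (y ∷ proj₂ I)))
    ≈⟨ Σ-cong (deshuffles n) (λ I → ++-cong (left I) (right I)) ⟩
  Σ (deshuffles n) (λ I → mul (letter y) (G I) ++ neg (mul (G I) (letter y)))
    ≈⟨ Σ-++ᶠ (deshuffles n) _ _ ⟩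
  Σ (deshuffles n) (λ I → mul (letter y) (G I)) ++ Σ (deshuffles n) (λ I → neg (mul (G I) (letter y)))
    ≈⟨ ++-cong (Σ-mulʳ (letter y) (deshuffles n) G) (≈-trans (neg-cong (Σ-mulˡ (deshuffles n) G (letter y))) (Σ-neg (deshuffles n) _)) ⟨
  mul (letter y) (Σ (deshuffles n) G) ++ neg (mul (Σ (deshuffles n) G) (letter y))
    ≈⟨ ++-cong (mul-congʳ (letter y) (antipode-convolution n)) (neg-cong (mul-congˡ (letter y) (antipode-convolution n))) ⟩
  mul (letter y) (constW n) ++ neg (mul (constW n) (letter y))
    ≈⟨ constW-commutator n ⟩
  [] ∎
  where
  open ≈-Reasoning
  G : Word × Word → Poly
  G I = mul (wordP (proj₁ I)) (antipodeW (proj₂ I))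
  left : ∀ I → mul (wordP (y ∷ proj₁ I)) (antipodeW (proj₂ I)) ≈ mul (letter y) (G I)
  left I = ≈-trans (mul-congˡ _ (≈-sym (mul-wordP (y ∷ []) (proj₁ I)))) (mul-assoc (letter y) (wordP (proj₁ I)) _)
  right : ∀ I → mul (wordP (proj₁ I)) (antipodeW (y ∷ proj₂ I)) ≈ neg (mul (G I) (letter y))
  right I = ≈-trans (mul-congʳ (wordP (proj₁ I)) (antipodeW-∷ y (proj₂ I)))
            (≈-trans (mul-negʳ _ _) (neg-cong (≈-sym (mul-assoc (wordP (proj₁ I)) (antipodeW (proj₂ I)) (letter y)))))
  constW-commutator : ∀ n → mul (letter y) (constW n) ++ neg (mul (constW n) (letter y)) ≈ []
  constW-commutator [] = ≈-trans (++-cong (mul-oneʳ (letter y)) (neg-cong (mul-oneˡ (letter y)))) (++-neg (letter y))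
  constW-commutator (_ ∷ _) = ++-cong (mul-[]ʳ (letter y)) (neg-cong (mul-[]ˡ (letter y)))

constW-convolution : ∀ u (F : Word → Poly) → Σ (deshuffles u) (λ I → mul (constW (proj₁ I)) (F (proj₂ I))) ≈ F u
constW-convolution [] F = ≈-trans (++-[] _) (mul-oneˡ (F []))
constW-convolution (y ∷ u) F =
  ≈-trans (Σ-deshuffles y u _) (≈-trans (Σ-cong (deshuffles u) (λ I → ++-cong (mul-[]ˡ _) ≈-refl))
          (constW-convolution u (λ r → F (y ∷ r))))

commutator : Poly → Poly → Poly
commutator p q = mul p q ++ neg (mul q p)

commutator-Linearˡ : ∀ q → Linear (λ p → commutator p q)
commutator-Linearˡ q = ++-Linear (mul-Linearˡ q) (neg-Linear (mul-Linearʳ q))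

commutator-Linearʳ : ∀ p → Linear (commutator p)
commutator-Linearʳ p = ++-Linear (mul-Linearʳ p) (neg-Linear (mul-Linearˡ p))

expand-br : ∀ a b → expand (br a b) ≈ commutator (expand a) (expand b)
expand-br a b = ++-cong (≈-sym (mul≈mulP (expand a) (expand b))) (neg-cong (≈-sym (mul≈mulP (expand b) (expand a))))

expandComb : LieComb → Poly
expandComb [] = []
expandComb ((c , s) ∷ L) = scale c (expand s) ++ expandComb L

expandComb≈Σw : ∀ L → expandComb L ≈ Σw L expand
expandComb≈Σw [] = ≈-refl
expandComb≈Σw ((c , s) ∷ L) = ++-cong ≈-refl (expandComb≈Σw L)

expandComb-++ : ∀ L L' → expandComb (L ++ L') ≈ expandComb L ++ expandComb L'
expandComb-++ [] L' = ≈-refl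
expandComb-++ ((c , s) ∷ L) L' =
  ≈-trans (++-cong ≈-refl (expandComb-++ L L')) (≡⇒≈ (sym (List.++-assoc (scale c (expand s)) (expandComb L) (expandComb L'))))

expandComb-map : ∀ {L} → Linear L → (g : LieTree → LieTree) → (∀ s → expand (g s) ≈ L (expand s)) →
  ∀ T → expandComb (map (λ { (c , s) → (c , g s) }) T) ≈ L (expandComb T)
expandComb-map lL g e [] = ≈-sym (lin-[] lL)
expandComb-map lL g e ((c , s) ∷ T) =
  ≈-trans (++-cong (≈-trans (scale-cong c (e s)) (≈-sym (lin-scale lL c (expand s)))) (expandComb-map lL g e T))
          (≈-sym (lin-++ lL (scale c (expand s)) (expandComb T)))

expandProd : List LieTree → Poly
expandProd [] = one
expandProd (s ∷ ts) = mul (expand s) (expandProd ts)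

expandProdRev : List LieTree → Poly
expandProdRev [] = one
expandProdRev (s ∷ ts) = mul (expandProdRev ts) (expand s)

expandProd-++ : ∀ xs ys → expandProd (xs ++ ys) ≈ mul (expandProd xs) (expandProd ys)
expandProd-++ [] ys = ≈-sym (mul-oneˡ (expandProd ys))
expandProd-++ (x ∷ xs) ys =
  ≈-trans (mul-congʳ (expand x) (expandProd-++ xs ys)) (≈-sym (mul-assoc (expand x) (expandProd xs) (expandProd ys)))

expandProd-reverse : ∀ p → expandProd (reverse p) ≈ expandProdRev p
expandProd-reverse [] = ≈-refl
expandProd-reverse (s ∷ p) =
  ≈-trans (≡⇒≈ (cong expandProd (List.unfold-reverse s p)))
  (≈-trans (expandProd-++ (reverse p) (s ∷ [])) (mul-cong (expandProd-reverse p) (mul-oneʳ (expand s))))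

expandProd-leaves : ∀ q → expandProd (map leaf q) ≈ wordP q
expandProd-leaves [] = ≈-refl
expandProd-leaves (y ∷ q) = ≈-trans (mul-congʳ (letter y) (expandProd-leaves q)) (mul-wordP (y ∷ []) q)

expandProdRev-leaves : ∀ p → expandProdRev (map leaf p) ≈ wordP (reverse p)
expandProdRev-leaves p = ≈-trans (≈-sym (expandProd-reverse (map leaf p)))
  (≈-trans (≡⇒≈ (cong expandProd (sym (List.reverse-map leaf p)))) (expandProd-leaves (reverse p)))

++-neg-cancel : ∀ a b c e → ((a ++ b) ++ c) ++ neg (b ++ e) ≈ a ++ (c ++ neg e)
++-neg-cancel a b c e = begin
  ((a ++ b) ++ c) ++ neg (b ++ e)          ≡⟨ cong (((a ++ b) ++ c) ++_) (scale-++ (- 1ℚ) b e) ⟩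
  ((a ++ b) ++ c) ++ (neg b ++ neg e)      ≈⟨ solve 5 (λ a b c b' e' → ((a ⊕ b) ⊕ c) ⊕ (b' ⊕ e') ⊜ (a ⊕ (c ⊕ e')) ⊕ (b ⊕ b'))
                                                   ≈-refl a b c (neg b) (neg e) ⟩
  (a ++ (c ++ neg e)) ++ (b ++ neg b)      ≈⟨ ++-cong ≈-refl (++-neg b) ⟩
  (a ++ (c ++ neg e)) ++ []                ≈⟨ ++-[] _ ⟩
  a ++ (c ++ neg e)                        ∎
  where
  open ≈-Reasoning
  open ++-Solver using (solve; _⊕_; _⊜_)

-- (−1)^|p| p̄ m q for sequences p, q of Lie elements, p̄ being p reversed; with m = x a letter ∉ V₀
-- these are the terms of (t₁ ⋯ tₘ) ▷ x, because t ▷ x = x t − t x.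
sandwich : List LieTree → Poly → List LieTree → Poly
sandwich p m q = scale (signOf (length p)) (mul (expandProdRev p) (mul m (expandProd q)))

sandwich-Linear : ∀ p q → Linear (λ m → sandwich p m q)
sandwich-Linear p q =
  ∘-Linear (scale-Linear (signOf (length p))) (∘-Linear (mul-Linearʳ (expandProdRev p)) (mul-Linearˡ (expandProd q)))

sandwich-∷ : ∀ t p m q → sandwich (t ∷ p) m q ++ sandwich p m (t ∷ q) ≈ sandwich p (commutator m (expand t)) q
sandwich-∷ t p m q = begin
  scale (- s) (mul (mul P E) (mul m Q)) ++ scale s (mul P (mul m (mul E Q)))
    ≈⟨ ++-cong (scale-neg s (mul (mul P E) (mul m Q))) ≈-refl ⟩
  scale s (neg (mul (mul P E) (mul m Q))) ++ scale s (mul P (mul m (mul E Q)))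
    ≡⟨ sym (scale-++ s (neg (mul (mul P E) (mul m Q))) _) ⟩
  scale s (neg (mul (mul P E) (mul m Q)) ++ mul P (mul m (mul E Q)))
    ≈⟨ scale-cong s (++-cong (neg-cong reassocˡ) reassocʳ) ⟩
  scale s (neg (mul P (mul (mul E m) Q)) ++ mul P (mul (mul m E) Q))
    ≈⟨ scale-cong s (++-comm≈ (neg (mul P (mul (mul E m) Q))) _) ⟩
  scale s (mul P (mul (mul m E) Q) ++ neg (mul P (mul (mul E m) Q)))
    ≈⟨ scale-cong s (++-cong ≈-refl (≈-sym (≈-trans (mul-congʳ P (mul-negˡ _ Q)) (mul-negʳ P _)))) ⟩
  scale s (mul P (mul (mul m E) Q) ++ mul P (mul (neg (mul E m)) Q))
    ≈⟨ scale-cong s (≈-trans (≈-sym (mul-++ʳ P _ _)) (mul-congʳ P (≈-sym (mul-++ˡ _ _ Q)))) ⟩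
  scale s (mul P (mul (commutator m E) Q)) ∎
  where
  open ≈-Reasoning
  s = signOf (length p)
  P = expandProdRev p
  E = expand t
  Q = expandProd q
  reassocˡ : mul (mul P E) (mul m Q) ≈ mul P (mul (mul E m) Q)
  reassocˡ = ≈-trans (mul-assoc P E (mul m Q)) (mul-congʳ P (≈-sym (mul-assoc E m Q)))
  reassocʳ : mul P (mul m (mul E Q)) ≈ mul P (mul (mul m E) Q)
  reassocʳ = mul-congʳ P (≈-sym (mul-assoc m E Q))

letterFactor : Poly → List LieTree → Poly
letterFactor m I = Σ (deshuffles I) (λ pq → sandwich (proj₁ pq) m (proj₂ pq))

letterFactor-∷ : ∀ t m l → letterFactor m (t ∷ l) ≈ letterFactor (commutator m (expand t)) l
letterFactor-∷ t m l = ≈-trans (Σ-deshuffles t l _) (Σ-cong (deshuffles l) (λ pq → sandwich-∷ t (proj₁ pq) m (proj₂ pq)))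

letterFactor-cong : ∀ {m m'} I → m ≈ m' → letterFactor m I ≈ letterFactor m' I
letterFactor-cong I e = Σ-cong (deshuffles I) (λ pq → lin-cong (sandwich-Linear (proj₁ pq) (proj₂ pq)) e)

module Action (V₀ : Letter → Bool) where

  open ≈-Reasoning

  abstract
    ∂ : LieTree → Poly → Poly
    ∂ t = derP V₀ t

    ∂≡derP : ∀ t p → ∂ t p ≡ derP V₀ t p
    ∂≡derP t p = refl

    ∂-linExt : ∀ t p → ∂ t p ≈ linExt (derW V₀ t) p
    ∂-linExt t [] = ≡⇒≈ (sym (linExt-[] (derW V₀ t)))
    ∂-linExt t ((c , w) ∷ p) rewrite linExt-∷ (derW V₀ t) c w p = ++-cong ≈-refl (∂-linExt t p)

  ∂-wordP : ∀ t u → ∂ t (wordP u) ≈ derW V₀ t u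
  ∂-wordP t u = ≈-trans (∂-linExt t (wordP u)) (linExt-wordP _ u)

  ∂-Linear : ∀ t → Linear (∂ t)
  ∂-Linear t = linear (λ {p} {q} e → ≈-trans (∂-linExt t p) (≈-trans (linExt-cong _ e) (≈-sym (∂-linExt t q))))
    (λ p → ≈-trans (∂-linExt t p) (linExt-congᶠ p (λ u → ≈-sym (∂-wordP t u))))

  derW-∷ : ∀ t x u → derW V₀ t (x ∷ u) ≈ mul (letterAct V₀ t x) (wordP u) ++ mul (letter x) (derW V₀ t u)
  derW-∷ t x u = ++-cong (≈-sym (mul≈mulP (letterAct V₀ t x) (wordP u))) (≈-sym (mul≈mulP (letter x) (derW V₀ t u)))

  derW-++ : ∀ t u v → derW V₀ t (u ++ v) ≈ mul (derW V₀ t u) (wordP v) ++ mul (wordP u) (derW V₀ t v)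
  derW-++ t [] v = ≈-sym (≈-trans (++-cong (mul-[]ˡ (wordP v)) ≈-refl) (mul-oneˡ (derW V₀ t v)))
  derW-++ t (x ∷ u) v = begin
    derW V₀ t (x ∷ (u ++ v))
      ≈⟨ derW-∷ t x (u ++ v) ⟩
    mul tx (wordP (u ++ v)) ++ mul (letter x) (derW V₀ t (u ++ v))
      ≈⟨ ++-cong (mul-congʳ tx (≈-sym (mul-wordP u v))) (mul-congʳ (letter x) (derW-++ t u v)) ⟩
    mul tx (mul (wordP u) (wordP v)) ++ mul (letter x) (mul (derW V₀ t u) (wordP v) ++ mul (wordP u) (derW V₀ t v))
      ≈⟨ ++-cong (mul-assoc tx (wordP u) (wordP v)) (≈-trans (++-cong (mul-assoc _ _ _) (mul-assoc _ _ _)) (≈-sym (mul-++ʳ (letter x) _ _))) ⟨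
    mul (mul tx (wordP u)) (wordP v) ++ (mul (mul (letter x) (derW V₀ t u)) (wordP v) ++ mul (mul (letter x) (wordP u)) (derW V₀ t v))
      ≈⟨ ++-assoc≈ (mul (mul tx (wordP u)) (wordP v)) (mul (mul (letter x) (derW V₀ t u)) (wordP v)) _ ⟨
    (mul (mul tx (wordP u)) (wordP v) ++ mul (mul (letter x) (derW V₀ t u)) (wordP v)) ++ mul (mul (letter x) (wordP u)) (derW V₀ t v)
      ≈⟨ ++-cong (mul-++ˡ _ _ (wordP v)) (mul-congˡ (derW V₀ t v) (≈-sym (mul-wordP (x ∷ []) u))) ⟨
    mul (mul tx (wordP u) ++ mul (letter x) (derW V₀ t u)) (wordP v) ++ mul (wordP (x ∷ u)) (derW V₀ t v)
      ≈⟨ ++-cong (mul-congˡ (wordP v) (derW-∷ t x u)) ≈-refl ⟨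
    mul (derW V₀ t (x ∷ u)) (wordP v) ++ mul (wordP (x ∷ u)) (derW V₀ t v) ∎
    where tx = letterAct V₀ t x

  ∂-mul : ∀ t p q → ∂ t (mul p q) ≈ mul (∂ t p) q ++ mul p (∂ t q)
  ∂-mul t = bilin-unique (λ p q → ∂ t (mul p q)) (λ p q → mul (∂ t p) q ++ mul p (∂ t q))
    (λ q → ∘-Linear (∂-Linear t) (mul-Linearˡ q)) (λ p → ∘-Linear (∂-Linear t) (mul-Linearʳ p))
    (λ q → ++-Linear (∘-Linear (mul-Linearˡ q) (∂-Linear t)) (mul-Linearˡ (∂ t q)))
    (λ p → ++-Linear (mul-Linearʳ (∂ t p)) (∘-Linear (mul-Linearʳ p) (∂-Linear t)))
    λ u v → begin
      ∂ t (mul (wordP u) (wordP v))                                    ≈⟨ lin-cong (∂-Linear t) (mul-wordP u v) ⟩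
      ∂ t (wordP (u ++ v))                                             ≈⟨ ∂-wordP t (u ++ v) ⟩
      derW V₀ t (u ++ v)                                               ≈⟨ derW-++ t u v ⟩
      mul (derW V₀ t u) (wordP v) ++ mul (wordP u) (derW V₀ t v)       ≈⟨ ++-cong (mul-congˡ (wordP v) (∂-wordP t u)) (mul-congʳ (wordP u) (∂-wordP t v)) ⟨
      mul (∂ t (wordP u)) (wordP v) ++ mul (wordP u) (∂ t (wordP v))   ∎

  ∂-one : ∀ t → ∂ t one ≈ []
  ∂-one t = ∂-wordP t []

  ∂-letter : ∀ t x → ∂ t (letter x) ≈ letterAct V₀ t x
  ∂-letter t x = begin
    ∂ t (letter x)                                                  ≈⟨ ∂-wordP t (x ∷ []) ⟩
    derW V₀ t (x ∷ [])                                              ≈⟨ derW-∷ t x [] ⟩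
    mul (letterAct V₀ t x) (wordP []) ++ mul (letter x) (derW V₀ t [])  ≈⟨ ++-cong (mul-oneʳ (letterAct V₀ t x)) (mul-[]ʳ (letter x)) ⟩
    letterAct V₀ t x ++ []                                          ≈⟨ ++-[] _ ⟩
    letterAct V₀ t x                                                ∎

  letterAct-V₀ : ∀ t x → V₀ x ≡ true → letterAct V₀ t x ≈ []
  letterAct-V₀ t x e rewrite e = ≈-refl

  letterAct-∉V₀ : ∀ t x → V₀ x ≡ false → letterAct V₀ t x ≈ commutator (letter x) (expand t)
  letterAct-∉V₀ t x e rewrite e = expand-br (leaf x) t

  ∂-commutator : ∀ t p q → ∂ t (commutator p q) ≈ commutator (∂ t p) q ++ commutator p (∂ t q)
  ∂-commutator t p q = begin
    ∂ t (mul p q ++ neg (mul q p))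
      ≈⟨ lin-++ (∂-Linear t) (mul p q) (neg (mul q p)) ⟩
    ∂ t (mul p q) ++ ∂ t (neg (mul q p))
      ≈⟨ ++-cong (∂-mul t p q) (≈-trans (lin-neg (∂-Linear t) (mul q p)) (neg-cong (∂-mul t q p))) ⟩
    (mul (∂ t p) q ++ mul p (∂ t q)) ++ neg (mul (∂ t q) p ++ mul q (∂ t p))
      ≡⟨ cong ((mul (∂ t p) q ++ mul p (∂ t q)) ++_) (scale-++ (- 1ℚ) (mul (∂ t q) p) (mul q (∂ t p))) ⟩
    (mul (∂ t p) q ++ mul p (∂ t q)) ++ (neg (mul (∂ t q) p) ++ neg (mul q (∂ t p)))
      ≈⟨ solve 4 (λ a b c d → (a ⊕ b) ⊕ (c ⊕ d) ⊜ (a ⊕ d) ⊕ (b ⊕ c)) ≈-refl (mul (∂ t p) q) (mul p (∂ t q)) (neg (mul (∂ t q) p)) (neg (mul q (∂ t p))) ⟩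
    commutator (∂ t p) q ++ commutator p (∂ t q) ∎
    where open ++-Solver using (solve; _⊕_; _⊜_)

  actLie-expand : ∀ t s → expandComb (actLie V₀ t s) ≈ ∂ t (expand s)
  actLie-expand t (leaf x) = ≈-trans (expandComb-letterAct (V₀ x)) (≈-sym (∂-letter t x))
    where
    expandComb-letterAct : ∀ b → expandComb (if b then [] else ((1ℚ , br (leaf x) t) ∷ [])) ≈ (if b then [] else expand (br (leaf x) t))
    expandComb-letterAct true = ≈-refl
    expandComb-letterAct false = ≈-trans (++-[] _) (scale-1 _)
  actLie-expand t (br a b) = begin
    expandComb (map (λ { (c , a') → (c , br a' b) }) (actLie V₀ t a) ++ map (λ { (c , b') → (c , br a b') }) (actLie V₀ t b))
      ≈⟨ expandComb-++ (map (λ { (c , a') → (c , br a' b) }) (actLie V₀ t a)) _ ⟩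
    expandComb (map (λ { (c , a') → (c , br a' b) }) (actLie V₀ t a)) ++ expandComb (map (λ { (c , b') → (c , br a b') }) (actLie V₀ t b))
      ≈⟨ ++-cong (expandComb-map (commutator-Linearˡ (expand b)) (λ a' → br a' b) (λ a' → expand-br a' b) (actLie V₀ t a))
                 (expandComb-map (commutator-Linearʳ (expand a)) (λ b' → br a b') (λ b' → expand-br a b') (actLie V₀ t b)) ⟩
    commutator (expandComb (actLie V₀ t a)) (expand b) ++ commutator (expand a) (expandComb (actLie V₀ t b))
      ≈⟨ ++-cong (lin-cong (commutator-Linearˡ (expand b)) (actLie-expand t a)) (lin-cong (commutator-Linearʳ (expand a)) (actLie-expand t b)) ⟩
    commutator (∂ t (expand a)) (expand b) ++ commutator (expand a) (∂ t (expand b))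
      ≈⟨ ∂-commutator t (expand a) (expand b) ⟨
    ∂ t (commutator (expand a) (expand b))
      ≈⟨ lin-cong (∂-Linear t) (expand-br a b) ⟨
    ∂ t (expand (br a b)) ∎

  -- The terms of t ▷ (t₁ ⋯ tₘ) given by the Leibniz rule; derVec with lists in place of vectors.
  leibniz : LieTree → List LieTree → List (ℚ × List LieTree)
  leibniz t [] = []
  leibniz t (s ∷ T) =
    map (λ cs → (proj₁ cs , proj₂ cs ∷ T)) (actLie V₀ t s) ++ map (λ cT → (proj₁ cT , s ∷ proj₂ cT)) (leibniz t T)

  Σw-leibniz-∷ : ∀ t s T F → Σw (leibniz t (s ∷ T)) F ≈ Σw (actLie V₀ t s) (λ s' → F (s' ∷ T)) ++ Σw (leibniz t T) (λ T' → F (s ∷ T'))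
  Σw-leibniz-∷ t s T F = ≈-trans (Σ-++ (map (λ cs → (proj₁ cs , proj₂ cs ∷ T)) (actLie V₀ t s)) _ _)
    (++-cong (≡⇒≈ (Σw-map (λ s' → s' ∷ T) (actLie V₀ t s) F)) (≡⇒≈ (Σw-map (λ T' → s ∷ T') (leibniz t T) F)))

  Σw-actLie : ∀ t s → Σw (actLie V₀ t s) expand ≈ ∂ t (expand s)
  Σw-actLie t s = ≈-trans (≈-sym (expandComb≈Σw (actLie V₀ t s))) (actLie-expand t s)

  Σw-leibniz-expandProd : ∀ t T → Σw (leibniz t T) expandProd ≈ ∂ t (expandProd T)
  Σw-leibniz-expandProd t [] = ≈-sym (∂-one t)
  Σw-leibniz-expandProd t (s ∷ T) = begin
    Σw (leibniz t (s ∷ T)) expandProd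
      ≈⟨ Σw-leibniz-∷ t s T expandProd ⟩
    Σw (actLie V₀ t s) (λ s' → mul (expand s') (expandProd T)) ++ Σw (leibniz t T) (λ T' → mul (expand s) (expandProd T'))
      ≈⟨ ++-cong (lin-Σw (mul-Linearˡ (expandProd T)) (actLie V₀ t s) expand) (lin-Σw (mul-Linearʳ (expand s)) (leibniz t T) expandProd) ⟨
    mul (Σw (actLie V₀ t s) expand) (expandProd T) ++ mul (expand s) (Σw (leibniz t T) expandProd)
      ≈⟨ ++-cong (mul-congˡ (expandProd T) (Σw-actLie t s)) (mul-congʳ (expand s) (Σw-leibniz-expandProd t T)) ⟩
    mul (∂ t (expand s)) (expandProd T) ++ mul (expand s) (∂ t (expandProd T))
      ≈⟨ ∂-mul t (expand s) (expandProd T) ⟨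
    ∂ t (expandProd (s ∷ T)) ∎

  Σw-leibniz-expandProdRev : ∀ t T → Σw (leibniz t T) expandProdRev ≈ ∂ t (expandProdRev T)
  Σw-leibniz-expandProdRev t [] = ≈-sym (∂-one t)
  Σw-leibniz-expandProdRev t (s ∷ T) = begin
    Σw (leibniz t (s ∷ T)) expandProdRev
      ≈⟨ Σw-leibniz-∷ t s T expandProdRev ⟩
    Σw (actLie V₀ t s) (λ s' → mul (expandProdRev T) (expand s')) ++ Σw (leibniz t T) (λ T' → mul (expandProdRev T') (expand s))
      ≈⟨ ++-cong (lin-Σw (mul-Linearʳ (expandProdRev T)) (actLie V₀ t s) expand) (lin-Σw (mul-Linearˡ (expand s)) (leibniz t T) expandProdRev) ⟨
    mul (expandProdRev T) (Σw (actLie V₀ t s) expand) ++ mul (Σw (leibniz t T) expandProdRev) (expand s)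
      ≈⟨ ++-cong (mul-congʳ (expandProdRev T) (Σw-actLie t s)) (mul-congˡ (expand s) (Σw-leibniz-expandProdRev t T)) ⟩
    mul (expandProdRev T) (∂ t (expand s)) ++ mul (∂ t (expandProdRev T)) (expand s)
      ≈⟨ ++-comm≈ (mul (expandProdRev T) (∂ t (expand s))) _ ⟩
    mul (∂ t (expandProdRev T)) (expand s) ++ mul (expandProdRev T) (∂ t (expand s))
      ≈⟨ ∂-mul t (expandProdRev T) (expand s) ⟨
    ∂ t (expandProdRev (s ∷ T)) ∎

  Σw-leibniz-cong : ∀ t p {G G' : List LieTree → Poly} → (∀ p' → length p' ≡ length p → G p' ≈ G' p') →
    Σw (leibniz t p) G ≈ Σw (leibniz t p) G'
  Σw-leibniz-cong t [] e = ≈-refl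
  Σw-leibniz-cong t (s ∷ p) {G} {G'} e =
    ≈-trans (Σw-leibniz-∷ t s p G) (≈-trans (++-cong (Σw-cong (actLie V₀ t s) (λ s' → e (s' ∷ p) refl))
      (Σw-leibniz-cong t p (λ p' l → e (s ∷ p') (cong suc l)))) (≈-sym (Σw-leibniz-∷ t s p G')))

  leibnizSplit : LieTree → (List LieTree × List LieTree → Poly) → List LieTree × List LieTree → Poly
  leibnizSplit t H (l , r) = Σw (leibniz t l) (λ l' → H (l' , r)) ++ Σw (leibniz t r) (λ r' → H (l , r'))

  leibnizSplit-∷ : ∀ t s H l r →
    Σw (actLie V₀ t s) (λ s' → H (s' ∷ l , r) ++ H (l , s' ∷ r)) ++ leibnizSplit t (λ { (l' , r') → H (s ∷ l' , r') ++ H (l' , s ∷ r') }) (l , r)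
      ≈ leibnizSplit t H (s ∷ l , r) ++ leibnizSplit t H (l , s ∷ r)
  leibnizSplit-∷ t s H l r = begin
    Σw (actLie V₀ t s) (λ s' → H (s' ∷ l , r) ++ H (l , s' ∷ r))
      ++ (Σw (leibniz t l) (λ l' → H (s ∷ l' , r) ++ H (l' , s ∷ r)) ++ Σw (leibniz t r) (λ r' → H (s ∷ l , r') ++ H (l , s ∷ r')))
      ≈⟨ ++-cong (Σw-++ᶠ (actLie V₀ t s) _ _) (++-cong (Σw-++ᶠ (leibniz t l) _ _) (Σw-++ᶠ (leibniz t r) _ _)) ⟩
    (a₁ ++ a₂) ++ ((b₁ ++ b₂) ++ (c₁ ++ c₂))
      ≈⟨ solve 6 (λ a₁ a₂ b₁ b₂ c₁ c₂ → (a₁ ⊕ a₂) ⊕ ((b₁ ⊕ b₂) ⊕ (c₁ ⊕ c₂)) ⊜ ((a₁ ⊕ b₁) ⊕ c₁) ⊕ (b₂ ⊕ (a₂ ⊕ c₂))) ≈-refl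
                 a₁ a₂ b₁ b₂ c₁ c₂ ⟩
    ((a₁ ++ b₁) ++ c₁) ++ (b₂ ++ (a₂ ++ c₂))
      ≈⟨ ++-cong (++-cong (Σw-leibniz-∷ t s l (λ l' → H (l' , r))) ≈-refl) (++-cong ≈-refl (Σw-leibniz-∷ t s r (λ r' → H (l , r')))) ⟨
    leibnizSplit t H (s ∷ l , r) ++ leibnizSplit t H (l , s ∷ r) ∎
    where
    open ++-Solver using (solve; _⊕_; _⊜_)
    a₁ = Σw (actLie V₀ t s) (λ s' → H (s' ∷ l , r))
    a₂ = Σw (actLie V₀ t s) (λ s' → H (l , s' ∷ r))
    b₁ = Σw (leibniz t l) (λ l' → H (s ∷ l' , r))
    b₂ = Σw (leibniz t l) (λ l' → H (l' , s ∷ r))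
    c₁ = Σw (leibniz t r) (λ r' → H (s ∷ l , r'))
    c₂ = Σw (leibniz t r) (λ r' → H (l , s ∷ r'))

  -- t ▷ (−) is a coderivation for the deshuffle coproduct.
  Σw-leibniz-deshuffles : ∀ t T (H : List LieTree × List LieTree → Poly) →
    Σw (leibniz t T) (λ T' → Σ (deshuffles T') H) ≈ Σ (deshuffles T) (leibnizSplit t H)
  Σw-leibniz-deshuffles t [] H = ≈-refl
  Σw-leibniz-deshuffles t (s ∷ T) H = begin
    Σw (leibniz t (s ∷ T)) (λ T' → Σ (deshuffles T') H)
      ≈⟨ Σw-leibniz-∷ t s T (λ T' → Σ (deshuffles T') H) ⟩
    Σw (actLie V₀ t s) (λ s' → Σ (deshuffles (s' ∷ T)) H) ++ Σw (leibniz t T) (λ T' → Σ (deshuffles (s ∷ T')) H)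
      ≈⟨ ++-cong (Σw-cong (actLie V₀ t s) (λ s' → Σ-deshuffles s' T H)) (Σw-cong (leibniz t T) (λ T' → Σ-deshuffles s T' H)) ⟩
    Σw (actLie V₀ t s) (λ s' → Σ (deshuffles T) (λ I → H (s' ∷ proj₁ I , proj₂ I) ++ H (proj₁ I , s' ∷ proj₂ I)))
      ++ Σw (leibniz t T) (λ T' → Σ (deshuffles T') H₁)
      ≈⟨ ++-cong (Σw-Σ (actLie V₀ t s) (deshuffles T) _) (Σw-leibniz-deshuffles t T H₁) ⟩
    Σ (deshuffles T) (λ I → Σw (actLie V₀ t s) (λ s' → H (s' ∷ proj₁ I , proj₂ I) ++ H (proj₁ I , s' ∷ proj₂ I)))
      ++ Σ (deshuffles T) (leibnizSplit t H₁)
      ≈⟨ Σ-++ᶠ (deshuffles T) _ _ ⟨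
    Σ (deshuffles T) (λ I → Σw (actLie V₀ t s) (λ s' → H (s' ∷ proj₁ I , proj₂ I) ++ H (proj₁ I , s' ∷ proj₂ I)) ++ leibnizSplit t H₁ I)
      ≈⟨ Σ-cong (deshuffles T) (λ I → leibnizSplit-∷ t s H (proj₁ I) (proj₂ I)) ⟩
    Σ (deshuffles T) (λ I → leibnizSplit t H (s ∷ proj₁ I , proj₂ I) ++ leibnizSplit t H (proj₁ I , s ∷ proj₂ I))
      ≈⟨ Σ-deshuffles s T (leibnizSplit t H) ⟨
    Σ (deshuffles (s ∷ T)) (leibnizSplit t H) ∎
    where
    H₁ : List LieTree × List LieTree → Poly
    H₁ (l , r) = H (s ∷ l , r) ++ H (l , s ∷ r)

  ∂-sandwich : ∀ t p m q → ∂ t (sandwich p m q) ≈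
    Σw (leibniz t p) (λ p' → sandwich p' m q) ++ (sandwich p (∂ t m) q ++ Σw (leibniz t q) (λ q' → sandwich p m q'))
  ∂-sandwich t p m q = begin
    ∂ t (scale s (mul P (mul m Q)))
      ≈⟨ lin-scale (∂-Linear t) s _ ⟩
    scale s (∂ t (mul P (mul m Q)))
      ≈⟨ scale-cong s (≈-trans (∂-mul t P _) (++-cong ≈-refl (≈-trans (mul-congʳ P (∂-mul t m Q)) (mul-++ʳ P _ _)))) ⟩
    scale s (mul (∂ t P) (mul m Q) ++ (mul P (mul (∂ t m) Q) ++ mul P (mul m (∂ t Q))))
      ≡⟨ trans (scale-++ s (mul (∂ t P) (mul m Q)) _) (cong (scale s (mul (∂ t P) (mul m Q)) ++_) (scale-++ s (mul P (mul (∂ t m) Q)) (mul P (mul m (∂ t Q))))) ⟩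
    scale s (mul (∂ t P) (mul m Q)) ++ (sandwich p (∂ t m) q ++ scale s (mul P (mul m (∂ t Q))))
      ≈⟨ ++-cong leibniz-left (++-cong ≈-refl leibniz-right) ⟨
    Σw (leibniz t p) (λ p' → sandwich p' m q) ++ (sandwich p (∂ t m) q ++ Σw (leibniz t q) (λ q' → sandwich p m q')) ∎
    where
    s = signOf (length p)
    P = expandProdRev p
    Q = expandProd q
    -- the terms of leibniz t p have the length of p, hence the sign of p
    leibniz-left : Σw (leibniz t p) (λ p' → sandwich p' m q) ≈ scale s (mul (∂ t P) (mul m Q))
    leibniz-left = begin
      Σw (leibniz t p) (λ p' → sandwich p' m q)
        ≈⟨ Σw-leibniz-cong t p (λ p' l → ≡⇒≈ (cong (λ n → scale (signOf n) (mul (expandProdRev p') (mul m Q))) l)) ⟩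
      Σw (leibniz t p) (λ p' → scale s (mul (expandProdRev p') (mul m Q)))
        ≈⟨ lin-Σw (∘-Linear (scale-Linear s) (mul-Linearˡ (mul m Q))) (leibniz t p) expandProdRev ⟨
      scale s (mul (Σw (leibniz t p) expandProdRev) (mul m Q))
        ≈⟨ scale-cong s (mul-congˡ (mul m Q) (Σw-leibniz-expandProdRev t p)) ⟩
      scale s (mul (∂ t P) (mul m Q)) ∎
    leibniz-right : Σw (leibniz t q) (λ q' → sandwich p m q') ≈ scale s (mul P (mul m (∂ t Q)))
    leibniz-right = ≈-trans (≈-sym (lin-Σw (∘-Linear (scale-Linear s) (∘-Linear (mul-Linearʳ P) (mul-Linearʳ m))) (leibniz t q) expandProd))
      (scale-cong s (mul-congʳ P (mul-congʳ m (Σw-leibniz-expandProd t q))))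

  ∂-letterFactor : ∀ t m l → ∂ t (letterFactor m l) ≈ letterFactor (∂ t m) l ++ Σw (leibniz t l) (letterFactor m)
  ∂-letterFactor t m l = begin
    ∂ t (letterFactor m l)
      ≈⟨ lin-Σ (∂-Linear t) (deshuffles l) _ ⟩
    Σ (deshuffles l) (λ pq → ∂ t (sandwich (proj₁ pq) m (proj₂ pq)))
      ≈⟨ Σ-cong (deshuffles l) (λ { (p , q) → ≈-trans (∂-sandwich t p m q) (swap12 (Σw (leibniz t p) (λ p' → sandwich p' m q)) (sandwich p (∂ t m) q) _) }) ⟩
    Σ (deshuffles l) (λ pq → sandwich (proj₁ pq) (∂ t m) (proj₂ pq) ++ (K (proj₁ pq) (proj₂ pq)))
      ≈⟨ Σ-++ᶠ (deshuffles l) _ _ ⟩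
    letterFactor (∂ t m) l ++ Σ (deshuffles l) (λ pq → K (proj₁ pq) (proj₂ pq))
      ≈⟨ ++-cong ≈-refl (Σw-leibniz-deshuffles t l (λ pq → sandwich (proj₁ pq) m (proj₂ pq))) ⟨
    letterFactor (∂ t m) l ++ Σw (leibniz t l) (letterFactor m) ∎
    where
    K : List LieTree → List LieTree → Poly
    K p q = Σw (leibniz t p) (λ p' → sandwich p' m q) ++ Σw (leibniz t q) (λ q' → sandwich p m q')
    swap12 : ∀ a b c → a ++ (b ++ c) ≈ b ++ (a ++ c)
    swap12 a b c = solve 3 (λ a b c → a ⊕ (b ⊕ c) ⊜ b ⊕ (a ⊕ c)) ≈-refl a b c
      where open ++-Solver using (solve; _⊕_; _⊜_)

  -- The terms of (t₁ ⋯ tₘ) ▷ v, as signed sequences of Lie factors: a letter x ∈ V₀ of v stays a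
  -- factor, a letter x ∉ V₀ absorbs a subsequence I of the tᵢ, split as I = (p , q), and becomes
  -- (−1)^|p| p̄ x q; the remaining tᵢ go to the later letters and all of them must be used.
  shapes : Word → List LieTree → List (ℚ × List LieTree)
  shapes [] [] = (1ℚ , []) ∷ []
  shapes [] (_ ∷ _) = []
  shapes (x ∷ v) T =
    if V₀ x then map (λ cs → (proj₁ cs , leaf x ∷ proj₂ cs)) (shapes v T)
    else concatMap (λ I → concatMap (λ pq → map (shapeTerm (proj₁ pq) (proj₂ pq)) (shapes v (proj₂ I))) (deshuffles (proj₁ I)))
                   (deshuffles T)
    where
    shapeTerm : List LieTree → List LieTree → ℚ × List LieTree → ℚ × List LieTree
    shapeTerm p q cs = (signOf (length p) * proj₁ cs , reverse p ++ leaf x ∷ q ++ proj₂ cs)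

  shapeSum : Word → List LieTree → Poly
  shapeSum v T = Σw (shapes v T) expandProd

  shapeSum-∷-V₀ : ∀ x v T → V₀ x ≡ true → shapeSum (x ∷ v) T ≈ mul (letter x) (shapeSum v T)
  shapeSum-∷-V₀ x v T e rewrite e =
    ≈-trans (≡⇒≈ (Σw-map (leaf x ∷_) (shapes v T) expandProd)) (≈-sym (lin-Σw (mul-Linearʳ (letter x)) (shapes v T) expandProd))

  shapeSum-∷-∉V₀ : ∀ x v T → V₀ x ≡ false →
    shapeSum (x ∷ v) T ≈ Σ (deshuffles T) (λ I → mul (letterFactor (letter x) (proj₁ I)) (shapeSum v (proj₂ I)))
  shapeSum-∷-∉V₀ x v T e rewrite e =
    ≈-trans (Σ-concatMap _ (deshuffles T) _) (Σ-cong (deshuffles T) (λ I →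
    ≈-trans (Σ-concatMap _ (deshuffles (proj₁ I)) _) (≈-trans (Σ-cong (deshuffles (proj₁ I)) (λ pq → term (proj₁ pq) (proj₂ pq) (proj₂ I)))
      (≈-sym (Σ-mulˡ (deshuffles (proj₁ I)) _ (shapeSum v (proj₂ I)))))))
    where
    expandProd-shape : ∀ p q sh → expandProd (reverse p ++ leaf x ∷ q ++ sh) ≈ mul (mul (expandProdRev p) (mul (letter x) (expandProd q))) (expandProd sh)
    expandProd-shape p q sh = begin
      expandProd (reverse p ++ leaf x ∷ q ++ sh)                              ≈⟨ expandProd-++ (reverse p) (leaf x ∷ q ++ sh) ⟩
      mul (expandProd (reverse p)) (mul (letter x) (expandProd (q ++ sh)))    ≈⟨ mul-cong (expandProd-reverse p) (mul-congʳ (letter x) (expandProd-++ q sh)) ⟩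
      mul (expandProdRev p) (mul (letter x) (mul (expandProd q) (expandProd sh)))
        ≈⟨ mul-congʳ (expandProdRev p) (mul-assoc (letter x) (expandProd q) (expandProd sh)) ⟨
      mul (expandProdRev p) (mul (mul (letter x) (expandProd q)) (expandProd sh))
        ≈⟨ mul-assoc (expandProdRev p) (mul (letter x) (expandProd q)) (expandProd sh) ⟨
      mul (mul (expandProdRev p) (mul (letter x) (expandProd q))) (expandProd sh) ∎
    term : ∀ p q r → Σ (map (λ cs → (signOf (length p) * proj₁ cs , reverse p ++ leaf x ∷ q ++ proj₂ cs)) (shapes v r))
                       (λ ca → scale (proj₁ ca) (expandProd (proj₂ ca)))
                     ≈ mul (sandwich p (letter x) q) (shapeSum v r)
    term p q r = begin
      Σ (map _ (shapes v r)) (λ ca → scale (proj₁ ca) (expandProd (proj₂ ca)))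
        ≡⟨ Σ-map _ (shapes v r) _ ⟩
      Σ (shapes v r) (λ cs → scale (s * proj₁ cs) (expandProd (reverse p ++ leaf x ∷ q ++ proj₂ cs)))
        ≈⟨ Σ-cong (shapes v r) (λ cs → ≈-trans (scale-cong (s * proj₁ cs) (expandProd-shape p q (proj₂ cs)))
                                       (≈-trans (≡⇒≈ (cong (λ k → scale k (mul M (expandProd (proj₂ cs)))) (*-comm s (proj₁ cs)))) (≈-sym (scale-scale (proj₁ cs) s _)))) ⟩
      Σ (shapes v r) (λ cs → scale (proj₁ cs) (scale s (mul (mul (expandProdRev p) (mul (letter x) (expandProd q))) (expandProd (proj₂ cs)))))
        ≈⟨ lin-Σw (∘-Linear (scale-Linear s) (mul-Linearʳ _)) (shapes v r) expandProd ⟨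
      scale s (mul (mul (expandProdRev p) (mul (letter x) (expandProd q))) (shapeSum v r))
        ≈⟨ mul-scaleˡ s _ (shapeSum v r) ⟨
      mul (sandwich p (letter x) q) (shapeSum v r) ∎
      where
      s = signOf (length p)
      M = mul (expandProdRev p) (mul (letter x) (expandProd q))

  -- The recursion  (t T) ▷ v = t ▷ (T ▷ v) − (t ▷ T) ▷ v  that defines act.
  ActRecursion : Word → LieTree → List LieTree → Set
  ActRecursion v t T = shapeSum v (t ∷ T) ≈ ∂ t (shapeSum v T) ++ neg (Σw (leibniz t T) (shapeSum v))

  actRecursion-[] : ∀ t T → ActRecursion [] t T
  actRecursion-[] t [] =
    ≈-sym (++-cong (≈-trans (lin-cong (∂-Linear t) (≈-trans (++-[] _) (scale-1 one))) (∂-one t)) ≈-refl)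
  actRecursion-[] t (s ∷ T) = ≈-sym (≈-trans (++-cong (lin-[] (∂-Linear t)) (neg-cong (≈-trans (Σw-leibniz-∷ t s T (shapeSum []))
      (++-cong (Σw-zero (actLie V₀ t s) {λ s' → shapeSum [] (s' ∷ T)} (λ _ → ≈-refl))
               (Σw-zero (leibniz t T) {λ T' → shapeSum [] (s ∷ T')} (λ _ → ≈-refl)))))) ≈-refl)

  actRecursion-V₀ : ∀ x v t → V₀ x ≡ true → (∀ T → ActRecursion v t T) → ∀ T → ActRecursion (x ∷ v) t T
  actRecursion-V₀ x v t e ih T = begin
    shapeSum (x ∷ v) (t ∷ T)
      ≈⟨ shapeSum-∷-V₀ x v (t ∷ T) e ⟩
    mul (letter x) (shapeSum v (t ∷ T))
      ≈⟨ mul-congʳ (letter x) (ih T) ⟩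
    mul (letter x) (∂ t (shapeSum v T) ++ neg (Σw (leibniz t T) (shapeSum v)))
      ≈⟨ ≈-trans (mul-++ʳ (letter x) _ _) (++-cong ≈-refl (mul-negʳ (letter x) _)) ⟩
    mul (letter x) (∂ t (shapeSum v T)) ++ neg (mul (letter x) (Σw (leibniz t T) (shapeSum v)))
      ≈⟨ ++-cong ≈-refl (neg-cong (lin-Σw (mul-Linearʳ (letter x)) (leibniz t T) (shapeSum v))) ⟩
    mul (letter x) (∂ t (shapeSum v T)) ++ neg (Σw (leibniz t T) (λ T' → mul (letter x) (shapeSum v T')))
      ≈⟨ ++-cong (++-cong ∂x≈[] ≈-refl) (neg-cong (Σw-cong (leibniz t T) (λ T' → shapeSum-∷-V₀ x v T' e))) ⟨
    (mul (∂ t (letter x)) (shapeSum v T) ++ mul (letter x) (∂ t (shapeSum v T))) ++ neg (Σw (leibniz t T) (shapeSum (x ∷ v)))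
      ≈⟨ ++-cong (≈-trans (lin-cong (∂-Linear t) (shapeSum-∷-V₀ x v T e)) (∂-mul t (letter x) (shapeSum v T))) ≈-refl ⟨
    ∂ t (shapeSum (x ∷ v) T) ++ neg (Σw (leibniz t T) (shapeSum (x ∷ v))) ∎
    where
    ∂x≈[] : mul (∂ t (letter x)) (shapeSum v T) ≈ []
    ∂x≈[] = ≈-trans (mul-congˡ _ (≈-trans (∂-letter t x) (letterAct-V₀ t x e))) (mul-[]ˡ _)

  -- Both sides of ActRecursion (x ∷ v) t T, for x ∉ V₀, reduce to the sum over deshuffles of T of these terms.
  recursionTerm : Letter → Word → LieTree → List LieTree × List LieTree → Poly
  recursionTerm x v t (l , r) =
    mul (letterFactor (letterAct V₀ t x) l) (shapeSum v r)
      ++ (mul (letterFactor (letter x) l) (∂ t (shapeSum v r)) ++ neg (mul (letterFactor (letter x) l) (Σw (leibniz t r) (shapeSum v))))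

  shapeSum-∷-∷-∉V₀ : ∀ x v t → V₀ x ≡ false → (∀ T → ActRecursion v t T) →
    ∀ T → shapeSum (x ∷ v) (t ∷ T) ≈ Σ (deshuffles T) (recursionTerm x v t)
  shapeSum-∷-∷-∉V₀ x v t e ih T = begin
    shapeSum (x ∷ v) (t ∷ T)
      ≈⟨ shapeSum-∷-∉V₀ x v (t ∷ T) e ⟩
    Σ (deshuffles (t ∷ T)) (λ I → mul (F (proj₁ I)) (shapeSum v (proj₂ I)))
      ≈⟨ Σ-deshuffles t T _ ⟩
    Σ (deshuffles T) (λ I → mul (F (t ∷ proj₁ I)) (shapeSum v (proj₂ I)) ++ mul (F (proj₁ I)) (shapeSum v (t ∷ proj₂ I)))
      ≈⟨ Σ-cong (deshuffles T) (λ I → ++-cong (mul-congˡ _ (F-∷ (proj₁ I)))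
           (≈-trans (mul-congʳ (F (proj₁ I)) (ih (proj₂ I))) (≈-trans (mul-++ʳ (F (proj₁ I)) _ _) (++-cong ≈-refl (mul-negʳ (F (proj₁ I)) _))))) ⟩
    Σ (deshuffles T) (recursionTerm x v t) ∎
    where
    F : List LieTree → Poly
    F = letterFactor (letter x)
    F-∷ : ∀ l → F (t ∷ l) ≈ letterFactor (letterAct V₀ t x) l
    F-∷ l = ≈-trans (letterFactor-∷ t (letter x) l) (letterFactor-cong l (≈-sym (letterAct-∉V₀ t x e)))

  ∂-shapeSum-∷-∉V₀ : ∀ x v t → V₀ x ≡ false →
    ∀ T → ∂ t (shapeSum (x ∷ v) T) ++ neg (Σw (leibniz t T) (shapeSum (x ∷ v))) ≈ Σ (deshuffles T) (recursionTerm x v t)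
  ∂-shapeSum-∷-∉V₀ x v t e T = begin
    ∂ t (shapeSum (x ∷ v) T) ++ neg (Σw (leibniz t T) (shapeSum (x ∷ v)))
      ≈⟨ ++-cong (lin-cong (∂-Linear t) (shapeSum-∷-∉V₀ x v T e)) (neg-cong (Σw-cong (leibniz t T) (λ T' → shapeSum-∷-∉V₀ x v T' e))) ⟩
    ∂ t (Σ (deshuffles T) G) ++ neg (Σw (leibniz t T) (λ T' → Σ (deshuffles T') G))
      ≈⟨ ++-cong (lin-Σ (∂-Linear t) (deshuffles T) G) (neg-cong (Σw-leibniz-deshuffles t T G)) ⟩
    Σ (deshuffles T) (λ I → ∂ t (G I)) ++ neg (Σ (deshuffles T) (leibnizSplit t G))
      ≈⟨ ++-cong (Σ-cong (deshuffles T) ∂G) (≈-trans (neg-cong (Σ-cong (deshuffles T) split)) (Σ-neg (deshuffles T) _)) ⟩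
    Σ (deshuffles T) (λ I → (aI I ++ bI I) ++ cI I) ++ Σ (deshuffles T) (λ I → neg (bI I ++ eI I))
      ≈⟨ Σ-++ᶠ (deshuffles T) _ _ ⟨
    Σ (deshuffles T) (λ I → ((aI I ++ bI I) ++ cI I) ++ neg (bI I ++ eI I))
      ≈⟨ Σ-cong (deshuffles T) (λ I → ++-neg-cancel (aI I) (bI I) (cI I) (eI I)) ⟩
    Σ (deshuffles T) (recursionTerm x v t) ∎
    where
    F : List LieTree → Poly
    F = letterFactor (letter x)
    G aI bI cI eI : List LieTree × List LieTree → Poly
    G (l , r) = mul (F l) (shapeSum v r)
    aI (l , r) = mul (letterFactor (letterAct V₀ t x) l) (shapeSum v r)
    bI (l , r) = mul (Σw (leibniz t l) F) (shapeSum v r)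
    cI (l , r) = mul (F l) (∂ t (shapeSum v r))
    eI (l , r) = mul (F l) (Σw (leibniz t r) (shapeSum v))
    ∂G : ∀ I → ∂ t (G I) ≈ (aI I ++ bI I) ++ cI I
    ∂G (l , r) = ≈-trans (∂-mul t (F l) (shapeSum v r))
      (++-cong (≈-trans (mul-congˡ _ (≈-trans (∂-letterFactor t (letter x) l) (++-cong (letterFactor-cong l (∂-letter t x)) ≈-refl)))
                        (mul-++ˡ _ _ (shapeSum v r))) ≈-refl)
    split : ∀ I → leibnizSplit t G I ≈ bI I ++ eI I
    split (l , r) = ++-cong (≈-sym (lin-Σw (mul-Linearˡ (shapeSum v r)) (leibniz t l) F))
                            (≈-sym (lin-Σw (mul-Linearʳ (F l)) (leibniz t r) (shapeSum v)))

  actRecursion : ∀ v t T → ActRecursion v t T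
  actRecursion [] t T = actRecursion-[] t T
  actRecursion (x ∷ v) t T = byMembership (V₀ x) refl
    where
    byMembership : ∀ b → V₀ x ≡ b → ActRecursion (x ∷ v) t T
    byMembership true e = actRecursion-V₀ x v t e (actRecursion v t) T
    byMembership false e =
      ≈-trans (shapeSum-∷-∷-∉V₀ x v t e (actRecursion v t) T) (≈-sym (∂-shapeSum-∷-∉V₀ x v t e T))

  shapeSum-[] : ∀ v → shapeSum v [] ≈ wordP v
  shapeSum-[] [] = ≈-trans (++-[] _) (scale-1 one)
  shapeSum-[] (x ∷ v) = byMembership (V₀ x) refl
    where
    letterFactor-[] : letterFactor (letter x) [] ≈ letter x
    letterFactor-[] = ≈-trans (++-[] _) (≈-trans (scale-1 _) (≈-trans (mul-oneˡ _) (mul-oneʳ (letter x))))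
    byMembership : ∀ b → V₀ x ≡ b → shapeSum (x ∷ v) [] ≈ wordP (x ∷ v)
    byMembership true e =
      ≈-trans (shapeSum-∷-V₀ x v [] e) (≈-trans (mul-congʳ (letter x) (shapeSum-[] v)) (mul-wordP (x ∷ []) v))
    byMembership false e = ≈-trans (shapeSum-∷-∉V₀ x v [] e)
      (≈-trans (++-[] _) (≈-trans (mul-cong letterFactor-[] (shapeSum-[] v)) (mul-wordP (x ∷ []) v)))

  Σw-derVec : ∀ {m} t (T : Vec LieTree m) (F : Vec LieTree m → Poly) (G : List LieTree → Poly) →
    (∀ T' → F T' ≈ G (toList T')) → Σw (derVec V₀ t T) F ≈ Σw (leibniz t (toList T)) G
  Σw-derVec t [] F G e = ≈-refl
  Σw-derVec t (s ∷ T) F G e = begin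
    Σw (map _ (actLie V₀ t s) ++ map _ (derVec V₀ t T)) F
      ≈⟨ Σ-++ (map _ (actLie V₀ t s)) (map _ (derVec V₀ t T)) _ ⟩
    Σw (map _ (actLie V₀ t s)) F ++ Σw (map _ (derVec V₀ t T)) F
      ≡⟨ cong₂ _++_ (Σw-map (_∷ T) (actLie V₀ t s) F) (Σw-map (s ∷_) (derVec V₀ t T) F) ⟩
    Σw (actLie V₀ t s) (λ s' → F (s' ∷ T)) ++ Σw (derVec V₀ t T) (λ T' → F (s ∷ T'))
      ≈⟨ ++-cong (Σw-cong (actLie V₀ t s) (λ s' → e (s' ∷ T))) (Σw-derVec t T (λ T' → F (s ∷ T')) (λ T' → G (s ∷ T')) (λ T' → e (s ∷ T'))) ⟩
    Σw (actLie V₀ t s) (λ s' → G (s' ∷ toList T)) ++ Σw (leibniz t (toList T)) (λ T' → G (s ∷ T'))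
      ≈⟨ Σw-leibniz-∷ t s (toList T) G ⟨
    Σw (leibniz t (s ∷ toList T)) G ∎

  act≈shapeSum : ∀ m (T : Vec LieTree m) v → act V₀ m T (wordP v) ≈ shapeSum v (toList T)
  act≈shapeSum zero [] v = ≈-sym (shapeSum-[] v)
  act≈shapeSum (suc m) (t ∷ T) v = begin
    derP V₀ t (act V₀ m T (wordP v)) ++ neg (concatMap (λ cT → scale (proj₁ cT) (act V₀ m (proj₂ cT) (wordP v))) (derVec V₀ t T))
      ≡⟨ cong₂ (λ p q → p ++ neg q) (sym (∂≡derP t _)) (concatMap≡Σ _ (derVec V₀ t T)) ⟩
    ∂ t (act V₀ m T (wordP v)) ++ neg (Σw (derVec V₀ t T) (λ T' → act V₀ m T' (wordP v)))
      ≈⟨ ++-cong (lin-cong (∂-Linear t) (act≈shapeSum m T v))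
                 (neg-cong (Σw-derVec t T (λ T' → act V₀ m T' (wordP v)) (shapeSum v) (λ T' → act≈shapeSum m T' v))) ⟩
    ∂ t (shapeSum v (toList T)) ++ neg (Σw (leibniz t (toList T)) (shapeSum v))
      ≈⟨ actRecursion v t (toList T) ⟨
    shapeSum v (t ∷ toList T) ∎

  -- closedForm b u v is dual to the right-hand side of the theorem: its coefficient at a is the
  -- coefficient of u ⊗ v in the sum for a, b recording whether the left boundary letter lies in V₀.
  closedForm : Bool → Word → Word → Poly
  closedForm b u [] = Ifun b u true
  closedForm b u (x ∷ v) =
    Σ (deshuffles u) (λ I → mul (Ifun b (proj₁ I) (V₀ x)) (mul (letter x) (closedForm (V₀ x) (proj₂ I) v)))

  closedForm-∷ : ∀ b u x v b' → V₀ x ≡ b' →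
    closedForm b u (x ∷ v) ≡ Σ (deshuffles u) (λ I → mul (Ifun b (proj₁ I) b') (mul (letter x) (closedForm b' (proj₂ I) v)))
  closedForm-∷ b u x v b' refl = refl

  leafShapeSum : Word → Word → Poly
  leafShapeSum r v = shapeSum v (map leaf r)

  ⊛Shape : Word → Word → Poly
  ⊛Shape u v = Σ (deshuffles u) (λ I → mul (wordP (proj₁ I)) (leafShapeSum (proj₂ I) v))

  letterFactor-leaves : ∀ x a →
    letterFactor (letter x) (map leaf a) ≈ Σ (deshuffles a) (λ J → mul (antipodeW (proj₁ J)) (mul (letter x) (wordP (proj₂ J))))
  letterFactor-leaves x a = ≈-trans (Σ-deshuffles-map leaf a _) (Σ-cong (deshuffles a) (λ { (p , q) → begin
    scale (signOf (length (map leaf p))) (mul (expandProdRev (map leaf p)) (mul (letter x) (expandProd (map leaf q))))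
      ≡⟨ cong (λ n → scale (signOf n) (mul (expandProdRev (map leaf p)) (mul (letter x) (expandProd (map leaf q))))) (List.length-map leaf p) ⟩
    scale (signOf (length p)) (mul (expandProdRev (map leaf p)) (mul (letter x) (expandProd (map leaf q))))
      ≈⟨ scale-cong (signOf (length p)) (mul-cong (expandProdRev-leaves p) (mul-congʳ (letter x) (expandProd-leaves q))) ⟩
    scale (signOf (length p)) (mul (wordP (reverse p)) (mul (letter x) (wordP q)))
      ≈⟨ mul-scaleˡ (signOf (length p)) (wordP (reverse p)) _ ⟨
    mul (scale (signOf (length p)) (wordP (reverse p))) (mul (letter x) (wordP q))
      ≈⟨ mul-congˡ _ (antipodeW≈ p) ⟨
    mul (antipodeW p) (mul (letter x) (wordP q)) ∎ }))

  leafShapeSum-∷-V₀ : ∀ x v r → V₀ x ≡ true → leafShapeSum r (x ∷ v) ≈ mul (letter x) (leafShapeSum r v)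
  leafShapeSum-∷-V₀ x v r e = shapeSum-∷-V₀ x v (map leaf r) e

  leafShapeSum-∷-∉V₀ : ∀ x v r → V₀ x ≡ false →
    leafShapeSum r (x ∷ v) ≈ Σ (deshuffles r) (λ I → mul (antipodeW (proj₁ I)) (mul (letter x) (⊛Shape (proj₂ I) v)))
  leafShapeSum-∷-∉V₀ x v r e = begin
    leafShapeSum r (x ∷ v)
      ≈⟨ shapeSum-∷-∉V₀ x v (map leaf r) e ⟩
    Σ (deshuffles (map leaf r)) (λ I → mul (letterFactor (letter x) (proj₁ I)) (shapeSum v (proj₂ I)))
      ≈⟨ Σ-deshuffles-map leaf r _ ⟩
    Σ (deshuffles r) (λ I → mul (letterFactor (letter x) (map leaf (proj₁ I))) (leafShapeSum (proj₂ I) v))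
      ≈⟨ Σ-cong (deshuffles r) (λ I → ≈-trans (mul-congˡ _ (letterFactor-leaves x (proj₁ I))) (Σ-mulˡ (deshuffles (proj₁ I)) _ _)) ⟩
    Σ (deshuffles r) (λ I → Σ (deshuffles (proj₁ I)) (λ J → F (proj₁ J) (proj₂ J) (proj₂ I)))
      ≈⟨ deshuffles-coassoc r F ⟨
    Σ (deshuffles r) (λ I → Σ (deshuffles (proj₂ I)) (λ J → F (proj₁ I) (proj₁ J) (proj₂ J)))
      ≈⟨ Σ-cong (deshuffles r) (λ I → ≈-trans (Σ-cong (deshuffles (proj₂ I)) (λ J → reassoc (proj₁ I) (proj₁ J) (proj₂ J)))
                                              (≈-sym (≈-trans (mul-congʳ (antipodeW (proj₁ I)) (Σ-mulʳ (letter x) (deshuffles (proj₂ I)) _))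
                                                              (Σ-mulʳ (antipodeW (proj₁ I)) (deshuffles (proj₂ I)) _)))) ⟩
    Σ (deshuffles r) (λ I → mul (antipodeW (proj₁ I)) (mul (letter x) (⊛Shape (proj₂ I) v))) ∎
    where
    F : Word → Word → Word → Poly
    F p q b = mul (mul (antipodeW p) (mul (letter x) (wordP q))) (leafShapeSum b v)
    reassoc : ∀ p q b → F p q b ≈ mul (antipodeW p) (mul (letter x) (mul (wordP q) (leafShapeSum b v)))
    reassoc p q b = ≈-trans (mul-assoc (antipodeW p) _ _) (mul-congʳ (antipodeW p) (mul-assoc (letter x) _ _))

  ⊛Shape-[] : ∀ u → ⊛Shape u [] ≈ wordP u
  ⊛Shape-[] [] = ≈-trans (++-[] _) (≈-trans (mul-congʳ one (≈-trans (++-[] _) (scale-1 one))) (mul-oneˡ one))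
  ⊛Shape-[] (y ∷ u) = begin
    ⊛Shape (y ∷ u) []
      ≈⟨ Σ-deshuffles y u _ ⟩
    Σ (deshuffles u) (λ I → mul (wordP (y ∷ proj₁ I)) (leafShapeSum (proj₂ I) []) ++ mul (wordP (proj₁ I)) (leafShapeSum (y ∷ proj₂ I) []))
      ≈⟨ Σ-cong (deshuffles u) (λ I → ≈-trans (++-cong (≈-trans (mul-congˡ _ (≈-sym (mul-wordP (y ∷ []) (proj₁ I)))) (mul-assoc (letter y) _ _))
                                                        (mul-[]ʳ (wordP (proj₁ I)))) (++-[] _)) ⟩
    Σ (deshuffles u) (λ I → mul (letter y) (mul (wordP (proj₁ I)) (leafShapeSum (proj₂ I) [])))
      ≈⟨ Σ-mulʳ (letter y) (deshuffles u) _ ⟨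
    mul (letter y) (⊛Shape u [])
      ≈⟨ ≈-trans (mul-congʳ (letter y) (⊛Shape-[] u)) (mul-wordP (y ∷ []) u) ⟩
    wordP (y ∷ u) ∎

  ⊛Shape≈closedForm : ∀ v u → ⊛Shape u v ≈ closedForm false u v
  leafShapeSum≈closedForm : ∀ v r → leafShapeSum r v ≈ closedForm true r v

  ⊛Shape≈closedForm [] u = ⊛Shape-[] u
  ⊛Shape≈closedForm (x ∷ v) u = byMembership (V₀ x) refl
    where
    byMembership : ∀ b → V₀ x ≡ b → ⊛Shape u (x ∷ v) ≈ closedForm false u (x ∷ v)
    byMembership true e =
      ≈-trans (Σ-cong (deshuffles u) (λ I → mul-congʳ (wordP (proj₁ I)) (≈-trans (leafShapeSum-∷-V₀ x v (proj₂ I) e)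
                                                      (mul-congʳ (letter x) (leafShapeSum≈closedForm v (proj₂ I))))))
              (≡⇒≈ (sym (closedForm-∷ false u x v true e)))
    -- u is deshuffled three ways, into l · S(p) in front of x and the rest; id ⋆ S = ε forces l = p = [].
    byMembership false e = begin
      ⊛Shape u (x ∷ v)
        ≈⟨ Σ-cong (deshuffles u) (λ I → ≈-trans (mul-congʳ (wordP (proj₁ I)) (leafShapeSum-∷-∉V₀ x v (proj₂ I) e))
                                                (Σ-mulʳ (wordP (proj₁ I)) (deshuffles (proj₂ I)) _)) ⟩
      Σ (deshuffles u) (λ I → Σ (deshuffles (proj₂ I)) (λ J → F (proj₁ I) (proj₁ J) (proj₂ J)))
        ≈⟨ deshuffles-coassoc u F ⟩
      Σ (deshuffles u) (λ I → Σ (deshuffles (proj₁ I)) (λ J → F (proj₁ J) (proj₂ J) (proj₂ I)))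
        ≈⟨ Σ-cong (deshuffles u) (λ I → ≈-trans (Σ-cong (deshuffles (proj₁ I)) (λ J → ≈-sym (mul-assoc (wordP (proj₁ J)) (antipodeW (proj₂ J)) _)))
                                                (≈-trans (≈-sym (Σ-mulˡ (deshuffles (proj₁ I)) _ _)) (mul-congˡ _ (antipode-convolution (proj₁ I))))) ⟩
      Σ (deshuffles u) (λ I → mul (constW (proj₁ I)) (Z (proj₂ I)))
        ≈⟨ constW-convolution u Z ⟩
      mul (letter x) (⊛Shape u v)
        ≈⟨ mul-congʳ (letter x) (⊛Shape≈closedForm v u) ⟩
      mul (letter x) (closedForm false u v)
        ≈⟨ constW-convolution u (λ r → mul (letter x) (closedForm false r v)) ⟨
      Σ (deshuffles u) (λ I → mul (Ifun false (proj₁ I) false) (mul (letter x) (closedForm false (proj₂ I) v)))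
        ≡⟨ closedForm-∷ false u x v false e ⟨
      closedForm false u (x ∷ v) ∎
      where
      Z : Word → Poly
      Z m = mul (letter x) (⊛Shape m v)
      F : Word → Word → Word → Poly
      F l p m = mul (wordP l) (mul (antipodeW p) (Z m))

  leafShapeSum≈closedForm [] [] = ≈-trans (++-[] _) (scale-1 one)
  leafShapeSum≈closedForm [] (y ∷ r) = ≈-refl
  leafShapeSum≈closedForm (x ∷ v) r = byMembership (V₀ x) refl
    where
    byMembership : ∀ b → V₀ x ≡ b → leafShapeSum r (x ∷ v) ≈ closedForm true r (x ∷ v)
    byMembership true e = begin
      leafShapeSum r (x ∷ v)                    ≈⟨ leafShapeSum-∷-V₀ x v r e ⟩
      mul (letter x) (leafShapeSum r v)         ≈⟨ mul-congʳ (letter x) (leafShapeSum≈closedForm v r) ⟩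
      mul (letter x) (closedForm true r v)      ≈⟨ constW-convolution r (λ r' → mul (letter x) (closedForm true r' v)) ⟨
      Σ (deshuffles r) (λ I → mul (Ifun true (proj₁ I) true) (mul (letter x) (closedForm true (proj₂ I) v)))
                                                ≡⟨ closedForm-∷ true r x v true e ⟨
      closedForm true r (x ∷ v)                 ∎
    byMembership false e = ≈-trans (leafShapeSum-∷-∉V₀ x v r e)
      (≈-trans (Σ-cong (deshuffles r) (λ I → mul-congʳ (antipodeW (proj₁ I)) (mul-congʳ (letter x) (⊛Shape≈closedForm v (proj₂ I)))))
               (≡⇒≈ (sym (closedForm-∷ true r x v false e))))

  ⊛I≈closedForm : ∀ u v → ⊛I V₀ u (wordP v) ≈ closedForm false u v
  ⊛I≈closedForm u v = begin
    ⊛I V₀ u (wordP v)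
      ≡⟨ trans (cong (concatMap _) (deshuffle≡deshuffles V₀ u)) (concatMap≡Σ _ (deshuffles u)) ⟩
    Σ (deshuffles u) (λ I → mulP (wordP (proj₁ I)) (actW V₀ (proj₂ I) (wordP v)))
      ≈⟨ Σ-cong (deshuffles u) (λ I → ≈-trans (≈-sym (mul≈mulP (wordP (proj₁ I)) _)) (mul-congʳ (wordP (proj₁ I)) (actW-leaves (proj₂ I)))) ⟩
    ⊛Shape u v
      ≈⟨ ⊛Shape≈closedForm v u ⟩
    closedForm false u v ∎
    where
    toList-leaves : ∀ r → toList (leaves V₀ r) ≡ map leaf r
    toList-leaves [] = refl
    toList-leaves (x ∷ r) = cong (leaf x ∷_) (toList-leaves r)
    actW-leaves : ∀ r → actW V₀ r (wordP v) ≈ leafShapeSum r v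
    actW-leaves r = ≈-trans (act≈shapeSum (length r) (leaves V₀ r) v) (≡⇒≈ (cong (shapeSum v) (toList-leaves r)))

module Coefficients (V₀ : Letter → Bool) where

  open Action V₀ using (closedForm)

  Σq-deshuffles-δ[]ʳ : ∀ u (g : Word → ℚ) → Σq (deshuffles u) (λ J → g (proj₁ J) * δ [] (proj₂ J)) ≡ g u
  Σq-deshuffles-δ[]ʳ [] g = trans (+-identityʳ _) (*-identityʳ (g []))
  Σq-deshuffles-δ[]ʳ (z ∷ u) g = trans (Σq-deshuffles z u _)
    (trans (Σq-cong (deshuffles u) (λ J → trans (cong (g (z ∷ proj₁ J) * δ [] (proj₂ J) +_) (*-zeroʳ (g (proj₁ J)))) (+-identityʳ _)))
           (Σq-deshuffles-δ[]ʳ u (λ l → g (z ∷ l))))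

  coeff-shP-one : ∀ P u → coeff (shP P one) u ≡ coeff P u
  coeff-shP-one P u = trans (coeff-shP P one u)
    (trans (Σq-cong (deshuffles u) (λ J → cong (coeff P (proj₁ J) *_) (coeff-wordP [] (proj₂ J)))) (Σq-deshuffles-δ[]ʳ u (coeff P)))

  -- The right-hand side for the word seg ++ a after its first segment has been read up to seg,
  -- b recording whether the letter opening that segment lies in V₀.
  rhsCoeff : Bool → Word → Word → Word → Word → ℚ
  rhsCoeff b seg a u v =
    Σq (masks (length a)) (λ m → δ (chosen V₀ (zip m a)) v * coeff (bigShuffle V₀ (pieces V₀ b seg (zip m a))) u)

  -- the terms in which the next letter x is one of the j_p
  rhsCoeffHead : Bool → Word → Letter → Word → Word → Word → ℚ
  rhsCoeffHead b seg x a u v = Σq (masks (length a)) (λ m →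
    δ (x ∷ chosen V₀ (zip m a)) v * coeff (shP (Ifun b seg (V₀ x)) (bigShuffle V₀ (pieces V₀ (V₀ x) [] (zip m a)))) u)

  rhsCoeff-∷ˡ : ∀ b seg x a u v → rhsCoeff b seg (x ∷ a) u v ≡ rhsCoeffHead b seg x a u v + rhsCoeff b (seg ++ x ∷ []) a u v
  rhsCoeff-∷ˡ b seg x a u v = trans (Σq-concatMap _ (masks (length a)) f)
    (trans (Σq-cong (masks (length a)) (λ m → cong (f (true ∷ m) +_) (+-identityʳ (f (false ∷ m))))) (Σq-+ (masks (length a)) _ _))
    where
    f : List Bool → ℚ
    f m = δ (chosen V₀ (zip m (x ∷ a))) v * coeff (bigShuffle V₀ (pieces V₀ b seg (zip m (x ∷ a)))) u

  rhsCoeff-[]ʳ : ∀ a b seg u → rhsCoeff b seg a u [] ≡ coeff (Ifun b (seg ++ a) true) u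
  rhsCoeff-[]ʳ [] b seg u =
    trans (+-identityʳ _) (trans (*-identityˡ _) (trans (coeff-shP-one (Ifun b seg true) u)
          (cong (λ s → coeff (Ifun b s true) u) (sym (List.++-identityʳ seg)))))
  rhsCoeff-[]ʳ (x ∷ a) b seg u = begin
    rhsCoeff b seg (x ∷ a) u []
      ≡⟨ rhsCoeff-∷ˡ b seg x a u [] ⟩
    rhsCoeffHead b seg x a u [] + rhsCoeff b (seg ++ x ∷ []) a u []
      ≡⟨ cong₂ _+_ (Σq-zero (masks (length a)) (λ m → *-zeroˡ (coeff (shP (Ifun b seg (V₀ x)) (bigShuffle V₀ (pieces V₀ (V₀ x) [] (zip m a)))) u))) (rhsCoeff-[]ʳ a b (seg ++ x ∷ []) u) ⟩
    0ℚ + coeff (Ifun b ((seg ++ x ∷ []) ++ a) true) u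
      ≡⟨ trans (+-identityˡ _) (cong (λ s → coeff (Ifun b s true) u) (List.++-assoc seg (x ∷ []) a)) ⟩
    coeff (Ifun b (seg ++ x ∷ a) true) u ∎
    where open ≡-Reasoning

  rhsCoeffHead-∷ʳ : ∀ b seg x a u y v → rhsCoeffHead b seg x a u (y ∷ v) ≡
    when (x ≡ᵇ y) (Σq (deshuffles u) (λ J → coeff (Ifun b seg (V₀ x)) (proj₁ J) * rhsCoeff (V₀ x) [] a (proj₂ J) v))
  rhsCoeffHead-∷ʳ b seg x a u y v = begin
    rhsCoeffHead b seg x a u (y ∷ v)
      ≡⟨ Σq-cong (masks (length a)) (λ m → trans (cong₂ _*_ (δ-∷ x y (chosen V₀ (zip m a)) v) (coeff-shP I (B m) u))
                                                 (when-*ˡ (x ≡ᵇ y) (δ (chosen V₀ (zip m a)) v) _)) ⟩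
    Σq (masks (length a)) (λ m → when (x ≡ᵇ y) (δ (chosen V₀ (zip m a)) v * Σq (deshuffles u) (λ J → coeff I (proj₁ J) * coeff (B m) (proj₂ J))))
      ≡⟨ Σq-when (x ≡ᵇ y) (masks (length a)) _ ⟩
    when (x ≡ᵇ y) (Σq (masks (length a)) (λ m → δ (chosen V₀ (zip m a)) v * Σq (deshuffles u) (λ J → coeff I (proj₁ J) * coeff (B m) (proj₂ J))))
      ≡⟨ cong (when (x ≡ᵇ y)) (trans (Σq-cong (masks (length a)) (λ m → sym (Σq-*ˡ (δ (chosen V₀ (zip m a)) v) (deshuffles u) _)))
                                        (Σq-swap (masks (length a)) (deshuffles u) _)) ⟩
    when (x ≡ᵇ y) (Σq (deshuffles u) (λ J → Σq (masks (length a)) (λ m → δ (chosen V₀ (zip m a)) v * (coeff I (proj₁ J) * coeff (B m) (proj₂ J)))))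
      ≡⟨ cong (when (x ≡ᵇ y)) (Σq-cong (deshuffles u) (λ J →
           trans (Σq-cong (masks (length a)) (λ m → lem (δ (chosen V₀ (zip m a)) v) (coeff I (proj₁ J)) (coeff (B m) (proj₂ J))))
                 (Σq-*ˡ (coeff I (proj₁ J)) (masks (length a)) (λ m → δ (chosen V₀ (zip m a)) v * coeff (B m) (proj₂ J))))) ⟩
    when (x ≡ᵇ y) (Σq (deshuffles u) (λ J → coeff I (proj₁ J) * rhsCoeff (V₀ x) [] a (proj₂ J) v)) ∎
    where
    open ≡-Reasoning
    I = Ifun b seg (V₀ x)
    B : List Bool → Poly
    B m = bigShuffle V₀ (pieces V₀ (V₀ x) [] (zip m a))
    lem : ∀ a b c → a * (b * c) ≡ b * (a * c)
    lem = solveℚ 3 (λ a b c → a :* (b :* c) := b :* (a :* c)) refl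

  rhsCoeffAt : Bool → Word → Word → Letter → Word → Word × Letter × Word → ℚ
  rhsCoeffAt b seg u y v (a₁ , x , a₂) =
    when (x ≡ᵇ y) (Σq (deshuffles u) (λ J → coeff (Ifun b (seg ++ a₁) (V₀ x)) (proj₁ J) * rhsCoeff (V₀ x) [] a₂ (proj₂ J) v))

  rhsCoeff-∷ʳ : ∀ a b seg u y v → rhsCoeff b seg a u (y ∷ v) ≡ Σq (letterSplittings a) (rhsCoeffAt b seg u y v)
  rhsCoeff-∷ʳ [] b seg u y v = trans (+-identityʳ _) (*-zeroˡ (coeff (bigShuffle V₀ (pieces V₀ b seg [])) u))
  rhsCoeff-∷ʳ (x ∷ a) b seg u y v = begin
    rhsCoeff b seg (x ∷ a) u (y ∷ v)
      ≡⟨ rhsCoeff-∷ˡ b seg x a u (y ∷ v) ⟩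
    rhsCoeffHead b seg x a u (y ∷ v) + rhsCoeff b (seg ++ x ∷ []) a u (y ∷ v)
      ≡⟨ cong₂ _+_ (trans (rhsCoeffHead-∷ʳ b seg x a u y v)
                          (cong (λ s → when (x ≡ᵇ y) (Σq (deshuffles u) (λ J → coeff (Ifun b s (V₀ x)) (proj₁ J) * rhsCoeff (V₀ x) [] a (proj₂ J) v)))
                                (sym (List.++-identityʳ seg))))
                   (rhsCoeff-∷ʳ a b (seg ++ x ∷ []) u y v) ⟩
    rhsCoeffAt b seg u y v ([] , x , a) + Σq (letterSplittings a) (rhsCoeffAt b (seg ++ x ∷ []) u y v)
      ≡⟨ cong (rhsCoeffAt b seg u y v ([] , x , a) +_)
              (trans (Σq-cong (letterSplittings a) shift) (sym (Σq-map _ (letterSplittings a) _))) ⟩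
    Σq (letterSplittings (x ∷ a)) (rhsCoeffAt b seg u y v) ∎
    where
    open ≡-Reasoning
    shift : ∀ s → rhsCoeffAt b (seg ++ x ∷ []) u y v s ≡ rhsCoeffAt b seg u y v (x ∷ proj₁ s , proj₂ s)
    shift (a₁ , x' , a₂) =
      cong (λ sg → when (x' ≡ᵇ y) (Σq (deshuffles u) (λ J → coeff (Ifun b sg (V₀ x')) (proj₁ J) * rhsCoeff (V₀ x') [] a₂ (proj₂ J) v)))
           (List.++-assoc seg (x ∷ []) a₁)

  coeff-closedForm : ∀ v b u a → coeff (closedForm b u v) a ≡ rhsCoeff b [] a u v
  coeff-closedForm [] b u a = trans (coeff-Ifun-sym b u true a) (sym (rhsCoeff-[]ʳ a b [] u))
  coeff-closedForm (y ∷ v) b u a = begin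
    coeff (closedForm b u (y ∷ v)) a
      ≡⟨ coeff-Σ (deshuffles u) _ a ⟩
    Σq (deshuffles u) (λ J → coeff (mul (Ifun b (proj₁ J) (V₀ y)) (mul (letter y) (closedForm (V₀ y) (proj₂ J) v))) a)
      ≡⟨ Σq-cong (deshuffles u) (λ J → coeff-mul-letter-mul (Ifun b (proj₁ J) (V₀ y)) y (closedForm (V₀ y) (proj₂ J) v) a) ⟩
    Σq (deshuffles u) (λ J → Σq (letterSplittings a) (λ s → when (y ≡ᵇ proj₁ (proj₂ s)) (term J s)))
      ≡⟨ Σq-swap (deshuffles u) (letterSplittings a) _ ⟩
    Σq (letterSplittings a) (λ s → Σq (deshuffles u) (λ J → when (y ≡ᵇ proj₁ (proj₂ s)) (term J s)))
      ≡⟨ Σq-cong (letterSplittings a) at-split ⟩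
    Σq (letterSplittings a) (rhsCoeffAt b [] u y v)
      ≡⟨ rhsCoeff-∷ʳ a b [] u y v ⟨
    rhsCoeff b [] a u (y ∷ v) ∎
    where
    open ≡-Reasoning
    term : Word × Word → Word × Letter × Word → ℚ
    term J s = coeff (Ifun b (proj₁ J) (V₀ y)) (proj₁ s) * coeff (closedForm (V₀ y) (proj₂ J) v) (proj₂ (proj₂ s))
    same-letter : ∀ a₁ x a₂ → x ≡ y →
      Σq (deshuffles u) (λ J → term J (a₁ , x , a₂)) ≡ Σq (deshuffles u) (λ J → coeff (Ifun b a₁ (V₀ x)) (proj₁ J) * rhsCoeff (V₀ x) [] a₂ (proj₂ J) v)
    same-letter a₁ x a₂ refl = Σq-cong (deshuffles u) (λ J →
      cong₂ _*_ (coeff-Ifun-sym b (proj₁ J) (V₀ x) a₁) (coeff-closedForm v (V₀ x) (proj₂ J) a₂))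
    at-split : ∀ s → Σq (deshuffles u) (λ J → when (y ≡ᵇ proj₁ (proj₂ s)) (term J s)) ≡ rhsCoeffAt b [] u y v s
    at-split (a₁ , x , a₂) =
      trans (Σq-when (y ≡ᵇ x) (deshuffles u) _)
      (trans (cong (λ c → when c (Σq (deshuffles u) (λ J → term J (a₁ , x , a₂)))) (≡ᵇ-sym y x))
             (when-cong (x ≡ᵇ y) (λ e → same-letter a₁ x a₂ (ℕ.≡ᵇ⇒≡ x y (subst T (sym e) tt)))))

  coeff₂-rhs : ∀ a u v → coeff₂ (rhs V₀ a) u v ≡ rhsCoeff false [] a u v
  coeff₂-rhs a u v = trans (coeff₂-concatMap _ (masks (length a)))
    (Σq-cong (masks (length a)) (λ m → coeff₂-tensor (chosen V₀ (zip m a)) (bigShuffle V₀ (pieces V₀ false [] (zip m a)))))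
    where
    coeff₂-++ : ∀ S S' → coeff₂ (S ++ S') u v ≡ coeff₂ S u v + coeff₂ S' u v
    coeff₂-++ [] S' = sym (+-identityˡ (coeff₂ S' u v))
    coeff₂-++ ((c , x , y) ∷ S) S' = trans (cong ((if wordEq x u ∧ wordEq y v then c else 0ℚ) +_) (coeff₂-++ S S'))
                                          (sym (+-assoc (if wordEq x u ∧ wordEq y v then c else 0ℚ) (coeff₂ S u v) (coeff₂ S' u v)))
    coeff₂-concatMap : ∀ {A : Set} (f : A → Poly₂) xs → coeff₂ (concatMap f xs) u v ≡ Σq xs (λ a → coeff₂ (f a) u v)
    coeff₂-concatMap f [] = refl
    coeff₂-concatMap f (a ∷ xs) = trans (coeff₂-++ (f a) (concatMap f xs)) (cong (coeff₂ (f a) u v +_) (coeff₂-concatMap f xs))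
    coeff₂-tensor : ∀ y P → coeff₂ (map (λ cw → (proj₁ cw , proj₂ cw , y)) P) u v ≡ δ y v * coeff P u
    coeff₂-tensor y [] = sym (*-zeroʳ (δ y v))
    coeff₂-tensor y ((c , w) ∷ P) =
      trans (cong₂ _+_ (if-∧ (wordEq w u) (wordEq y v)) (coeff₂-tensor y P)) (sym (*-distribˡ-+ (δ y v) (if wordEq w u then c else 0ℚ) (coeff P u)))
      where
      if-∧ : ∀ b₁ b₂ → (if b₁ ∧ b₂ then c else 0ℚ) ≡ (if b₂ then 1ℚ else 0ℚ) * (if b₁ then c else 0ℚ)
      if-∧ true true = sym (*-identityˡ c)
      if-∧ true false = sym (*-zeroˡ c)
      if-∧ false true = sym (*-identityˡ 0ℚ)
      if-∧ false false = sym (*-zeroˡ 0ℚ)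

theorem3p17 : (V₀ : Letter → Bool) (a u v : Word) →
    ΔIcoeff V₀ a u v ≡ coeff₂ (rhs V₀ a) u v
theorem3p17 V₀ a u v = begin
  ΔIcoeff V₀ a u v                         ≡⟨ at (⊛I≈closedForm u v) a ⟩
  coeff (closedForm false u v) a           ≡⟨ coeff-closedForm v false u a ⟩
  rhsCoeff false [] a u v                  ≡⟨ coeff₂-rhs a u v ⟨
  coeff₂ (rhs V₀ a) u v                    ∎
  where
  open ≡-Reasoning
  open Action V₀ using (⊛I≈closedForm; closedForm)
  open Coefficients V₀ using (coeff-closedForm; rhsCoeff; coeff₂-rhs)
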